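{- Let $r$ be a complex number with $r\notin\{ -\tfrac12,-\tfrac22,-\tfrac32,\ldots\}$ and let $n\ge 0$ be an integer. Then, as polynomials in $x$, $$d_{n}^{(r)}(x)^2=\binom{n+2r}{n}\sum_{m=0}^n\frac{\binom{x-r}{m}\binom{x+r+m}{m}\binom{n+2r+m}{n-m}}{\binom{m+2r}{m}}4^m.$$
   Context: For a complex number (or polynomial) $a$ and an integer $k\ge0$, $\binom{a}{k}=a(a-1)\cdots(a-k+1)/k!$, and $\binom{a}{k}=0$ for $k<0$. For a parameter $r$ and an integer $n\ge 0$, define the polynomial $d_n^{(r)}(x)=\sum_{k=0}^n\binom{x+r+k}{k}\binom{x-r}{n-k}$. -}

module Defs where

open import Level using (Level; suc; _⊔_)
open import Data.Nat as ℕ using (ℕ; zero)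
open import Relation.Nullary using (¬_)
open import Algebra.Bundles using (CommutativeRing)

fromℕ : ∀ {c ℓ} (R : CommutativeRing c ℓ) → ℕ → CommutativeRing.Carrier R
fromℕ R zero = CommutativeRing.0# R
fromℕ R (ℕ.suc n) = CommutativeRing._+_ R (CommutativeRing.1# R) (fromℕ R n)

record CharZeroField (c ℓ : Level) : Set (Level.suc (c ⊔ ℓ)) where
  field
    cring : CommutativeRing c ℓ
  open CommutativeRing cring public
  field
    _⁻¹     : Carrier → Carrier
    0≉1     : ¬ (0# ≈ 1#)
    inverse : ∀ a → ¬ (a ≈ 0#) → (a * (a ⁻¹)) ≈ 1#
    char0   : ∀ n → ¬ (fromℕ cring (ℕ.suc n) ≈ 0#)

module Binomials {c ℓ} (F : CharZeroField c ℓ) where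
  open CharZeroField F

  ι : ℕ → Carrier
  ι = fromℕ cring

  _÷_ : Carrier → Carrier → Carrier
  a ÷ b = a * (b ⁻¹)

  falling : Carrier → ℕ → Carrier
  falling a zero = 1#
  falling a (ℕ.suc k) = falling a k * (a - ι k)

  fact : ℕ → Carrier
  fact k = ι (k ℕ.!)

  binom : Carrier → ℕ → Carrier
  binom a k = falling a k ÷ fact k

  sumTo : ℕ → (ℕ → Carrier) → Carrier
  sumTo zero f = f 0
  sumTo (ℕ.suc n) f = sumTo n f + f (ℕ.suc n)

  pow : Carrier → ℕ → Carrier
  pow a zero = 1#
  pow a (ℕ.suc m) = pow a m * a

  d : ℕ → Carrier → Carrier → Carrier
  d n r x = sumTo n (λ k → binom (x + r + ι k) k * binom (x - r) (n ℕ.∸ k))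

{-# OPTIONS --safe #-}
module Submission where

-- Write ρ = 2r, A = 2x+1 and d̂ₙ = n! dₙ. Splitting (n+1) in (n+1) d_{n+1} as k + (n+1-k)
-- and applying the two Pascal-type recurrences of the binomial factors gives the
-- three-term recurrence d̂_{n+2} = A d̂_{n+1} + eₙ d̂ₙ with eₙ = (n+1)(ρ+n+1).
-- On the other side, (n!)² times the right-hand side is a sum Sₙ = Σₘ 4ᵐ Φₘ σ(n,m) with
-- Φₘ = (x-r)ₘ↓ (x+r+m)ₘ↓ and σ(n,m) = C(n,m) (ρ+m+1)^{(n-m)} (ρ+2m+1)^{(n-m)}; the
-- hypothesis on r is what allows dividing by C(m+2r, m). Since A² Φₘ = 4 Φ_{m+1} +
-- (ρ+2m+1)² Φₘ, multiplication by A² is an index shift, and coefficientwise identities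
-- show that Sₙ, together with a companion sum Wₙ, satisfies the recurrences of d̂ₙ² and
-- d̂_{n+1} d̂ₙ / A. Induction on these three quantities gives d̂ₙ² = Sₙ.

open import Defs
open import Level using (Level)
open import Algebra.Bundles using (CommutativeRing)
import Algebra.Solver.Ring as RingSolver
import Algebra.Solver.Ring.AlmostCommutativeRing as ACR
open import Data.Integer as ℤ using (ℤ; +_; -[1+_])
import Data.Integer.Properties as ℤ
import Data.Maybe as Maybe
open import Data.Nat as ℕ using (ℕ; zero; suc; _≤_; _<_; z≤n; s≤s; _∸_; _!)
import Data.Nat.Properties as ℕ
open import Data.Nat.Combinatorics using (_C_; nCk≡n!/k![n-k]!; k![n∸k]!∣n!; nCk≡nC[n∸k]; nC1≡n; k>n⇒nCk≡0; nCn≡1)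
open import Data.Nat.DivMod using (m/n*n≡m)
open import Data.Product using (_×_; _,_; proj₁)
open import Data.Sum using (inj₁; inj₂)
open import Relation.Binary.PropositionalEquality as ≡ using (_≡_)
open import Relation.Nullary using (¬_)
open import Relation.Nullary.Decidable using (dec⇒maybe)

module ℤ-Solver {c ℓ} (R : CommutativeRing c ℓ) where
  open CommutativeRing R
  open import Algebra.Properties.Ring ring
    using (-‿distribˡ-*; -‿distribʳ-*; -‿involutive; -0#≈0#; -‿+-comm)
  open import Algebra.Properties.CommutativeSemigroup +-commutativeSemigroup
    using (x∙yz≈y∙xz)
  open import Relation.Binary.Reasoning.Setoid setoid

  private
    ι : ℕ → Carrier
    ι = fromℕ R

  fromℕ-+ : ∀ m n → ι (m ℕ.+ n) ≈ ι m + ι n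
  fromℕ-+ zero n = sym (+-identityˡ _)
  fromℕ-+ (suc m) n = trans (+-congˡ (fromℕ-+ m n)) (sym (+-assoc _ _ _))

  fromℕ-* : ∀ m n → ι (m ℕ.* n) ≈ ι m * ι n
  fromℕ-* zero n = sym (zeroˡ _)
  fromℕ-* (suc m) n = begin
    ι (n ℕ.+ m ℕ.* n)          ≈⟨ fromℕ-+ n (m ℕ.* n) ⟩
    ι n + ι (m ℕ.* n)          ≈⟨ +-cong (sym (*-identityˡ _)) (fromℕ-* m n) ⟩
    1# * ι n + ι m * ι n       ≈⟨ distribʳ _ _ _ ⟨
    (1# + ι m) * ι n           ∎

  fromℤ : ℤ → Carrier
  fromℤ (+ n) = ι n
  fromℤ -[1+ n ] = - ι (suc n)

  fromℤ-⊖ : ∀ m n → fromℤ (m ℤ.⊖ n) ≈ ι m - ι n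
  fromℤ-⊖ zero zero = sym (trans (+-congˡ -0#≈0#) (+-identityʳ _))
  fromℤ-⊖ (suc m) zero = sym (trans (+-congˡ -0#≈0#) (+-identityʳ _))
  fromℤ-⊖ zero (suc n) = sym (+-identityˡ _)
  fromℤ-⊖ (suc m) (suc n) rewrite ℤ.[1+m]⊖[1+n]≡m⊖n m n = begin
    fromℤ (m ℤ.⊖ n)                     ≈⟨ fromℤ-⊖ m n ⟩
    ι m - ι n                           ≈⟨ +-identityˡ _ ⟨
    0# + (ι m - ι n)                    ≈⟨ +-congʳ (-‿inverseʳ 1#) ⟨
    (1# - 1#) + (ι m - ι n)             ≈⟨ +-assoc _ _ _ ⟩
    1# + (- 1# + (ι m - ι n))           ≈⟨ +-congˡ (x∙yz≈y∙xz _ _ _) ⟩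
    1# + (ι m + (- 1# - ι n))           ≈⟨ +-assoc _ _ _ ⟨
    (1# + ι m) + (- 1# - ι n)           ≈⟨ +-congˡ (-‿+-comm 1# (ι n)) ⟩
    (1# + ι m) - (1# + ι n)             ∎

  fromℤ-neg : ∀ i → fromℤ (ℤ.- i) ≈ - fromℤ i
  fromℤ-neg (+ zero) = sym -0#≈0#
  fromℤ-neg (+ suc n) = refl
  fromℤ-neg -[1+ n ] = sym (-‿involutive _)

  fromℤ-+ : ∀ i j → fromℤ (i ℤ.+ j) ≈ fromℤ i + fromℤ j
  fromℤ-+ (+ m) (+ n) = fromℕ-+ m n
  fromℤ-+ (+ m) -[1+ n ] = fromℤ-⊖ m (suc n)
  fromℤ-+ -[1+ m ] (+ n) = trans (fromℤ-⊖ n (suc m)) (+-comm _ _)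
  fromℤ-+ -[1+ m ] -[1+ n ] = begin
    - (1# + ι (suc m ℕ.+ n))          ≈⟨ -‿cong (+-congˡ (fromℕ-+ (suc m) n)) ⟩
    - (1# + (ι (suc m) + ι n))        ≈⟨ -‿cong (x∙yz≈y∙xz _ _ _) ⟩
    - (ι (suc m) + ι (suc n))         ≈⟨ -‿+-comm _ _ ⟨
    - ι (suc m) + - ι (suc n)         ∎

  fromℤ-*⁺ : ∀ m n → fromℤ (+ m ℤ.* + n) ≈ ι m * ι n
  fromℤ-*⁺ m n rewrite ≡.sym (ℤ.pos-* m n) = fromℕ-* m n

  fromℤ-* : ∀ i j → fromℤ (i ℤ.* j) ≈ fromℤ i * fromℤ j
  fromℤ-* (+ m) (+ n) = fromℤ-*⁺ m n
  fromℤ-* (+ m) -[1+ n ] rewrite ≡.sym (ℤ.neg-distribʳ-* (+ m) (+ suc n)) =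
    trans (fromℤ-neg (+ m ℤ.* + suc n)) (trans (-‿cong (fromℤ-*⁺ m (suc n))) (-‿distribʳ-* _ _))
  fromℤ-* -[1+ m ] (+ n) rewrite ≡.sym (ℤ.neg-distribˡ-* (+ suc m) (+ n)) =
    trans (fromℤ-neg (+ suc m ℤ.* + n)) (trans (-‿cong (fromℤ-*⁺ (suc m) n)) (-‿distribˡ-* _ _))
  fromℤ-* -[1+ m ] -[1+ n ] rewrite ℤ.neg-distribˡ-* (+ suc m) -[1+ n ]
    | ≡.sym (ℤ.neg-distribʳ-* (+ suc m) (+ suc n)) | ℤ.neg-involutive (+ suc m ℤ.* + suc n) = begin
    fromℤ (+ suc m ℤ.* + suc n)       ≈⟨ fromℤ-*⁺ (suc m) (suc n) ⟩
    ι (suc m) * ι (suc n)             ≈⟨ -‿involutive _ ⟨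
    - - (ι (suc m) * ι (suc n))       ≈⟨ -‿cong (-‿distribʳ-* _ _) ⟩
    - (ι (suc m) * - ι (suc n))       ≈⟨ -‿distribˡ-* _ _ ⟩
    - ι (suc m) * - ι (suc n)         ∎

  -- fromℤ, except that 1 goes to 1# itself (not 1# + 0#), so that in a
  -- solver equation con (+ 1) denotes 1# and con (+ n) denotes ι n.
  coefficient : ℤ → Carrier
  coefficient (+ 1) = 1#
  coefficient i = fromℤ i

  coefficient≈fromℤ : ∀ i → coefficient i ≈ fromℤ i
  coefficient≈fromℤ (+ zero) = refl
  coefficient≈fromℤ (+ suc zero) = sym (+-identityʳ 1#)
  coefficient≈fromℤ (+ suc (suc n)) = refl
  coefficient≈fromℤ -[1+ n ] = refl

  private
    ⟨_⟩ : ∀ i → coefficient i ≈ fromℤ i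
    ⟨_⟩ = coefficient≈fromℤ

  morphism : CommutativeRing.rawRing ℤ.+-*-commutativeRing
               ACR.-Raw-AlmostCommutative⟶ ACR.fromCommutativeRing R
  morphism = record
    { ⟦_⟧ = coefficient
    ; +-homo = λ i j → trans ⟨ i ℤ.+ j ⟩ (trans (fromℤ-+ i j) (sym (+-cong ⟨ i ⟩ ⟨ j ⟩)))
    ; *-homo = λ i j → trans ⟨ i ℤ.* j ⟩ (trans (fromℤ-* i j) (sym (*-cong ⟨ i ⟩ ⟨ j ⟩)))
    ; -‿homo = λ i → trans ⟨ ℤ.- i ⟩ (trans (fromℤ-neg i) (-‿cong (sym ⟨ i ⟩)))
    ; 0-homo = refl
    ; 1-homo = refl
    }

  open RingSolver _ (ACR.fromCommutativeRing R) morphism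
    (λ i j → Maybe.map (λ i≡j → reflexive (≡.cong coefficient i≡j)) (dec⇒maybe (i ℤ.≟ j))) public

module _ where
  open import Data.Nat using (_+_; _*_)
  open import Data.Nat.Properties
  open import Data.Nat.Solver using (module +-*-Solver)
  open +-*-Solver
  open import Relation.Binary.PropositionalEquality

  nCk*k!*[n∸k]!≡n! : ∀ {n k} → k ≤ n → (n C k) * (k ! * (n ∸ k) !) ≡ n !
  nCk*k!*[n∸k]!≡n! {n} {k} k≤n =
    trans (cong (_* (k ! * (n ∸ k) !)) (nCk≡n!/k![n-k]! k≤n)) (m/n*n≡m (k![n∸k]!∣n! k≤n))
    where instance _ = k !* (n ∸ k) !≢0

  [p+q]Cp*p!*q!≡[p+q]! : ∀ p q → ((p + q) C p) * (p ! * q !) ≡ (p + q) !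
  [p+q]Cp*p!*q!≡[p+q]! p q =
    subst (λ j → ((p + q) C p) * (p ! * j !) ≡ (p + q) !) (m+n∸m≡n p q) (nCk*k!*[n∸k]!≡n! (m≤m+n p q))

  [1+p+q]C[1+p]*[1+p]≡[1+p+q]*[p+q]Cp : ∀ p q →
    (suc (p + q) C suc p) * suc p ≡ suc (p + q) * ((p + q) C p)
  [1+p+q]C[1+p]*[1+p]≡[1+p+q]*[p+q]Cp p q =
    *-cancelʳ-≡ ((suc (p + q) C suc p) * suc p) (suc (p + q) * ((p + q) C p)) (p ! * q !) {{_!*_!≢0 p q}} (begin
      (suc (p + q) C suc p) * suc p * (p ! * q !)   ≡⟨ solve 4 (λ c p a b → c :* (con 1 :+ p) :* (a :* b) := c :* ((con 1 :+ p) :* a :* b)) refl (suc (p + q) C suc p) p (p !) (q !) ⟩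
      (suc (p + q) C suc p) * (suc p ! * q !)       ≡⟨ [p+q]Cp*p!*q!≡[p+q]! (suc p) q ⟩
      suc (p + q) * (p + q) !                       ≡⟨ cong (suc (p + q) *_) ([p+q]Cp*p!*q!≡[p+q]! p q) ⟨
      suc (p + q) * (((p + q) C p) * (p ! * q !))   ≡⟨ *-assoc (suc (p + q)) ((p + q) C p) (p ! * q !) ⟨
      suc (p + q) * ((p + q) C p) * (p ! * q !)     ∎)
    where open ≡-Reasoning

  [p+1+q]Cp*[1+q]≡[1+p+q]*[p+q]Cp : ∀ p q →
    ((p + suc q) C p) * suc q ≡ suc (p + q) * ((p + q) C p)
  [p+1+q]Cp*[1+q]≡[1+p+q]*[p+q]Cp p q =
    *-cancelʳ-≡ (((p + suc q) C p) * suc q) (suc (p + q) * ((p + q) C p)) (p ! * q !) {{_!*_!≢0 p q}} (begin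
      ((p + suc q) C p) * suc q * (p ! * q !)       ≡⟨ solve 4 (λ c q a b → c :* (con 1 :+ q) :* (a :* b) := c :* (a :* ((con 1 :+ q) :* b))) refl ((p + suc q) C p) q (p !) (q !) ⟩
      ((p + suc q) C p) * (p ! * suc q !)           ≡⟨ [p+q]Cp*p!*q!≡[p+q]! p (suc q) ⟩
      (p + suc q) !                                 ≡⟨ cong _! (+-suc p q) ⟩
      suc (p + q) * (p + q) !                       ≡⟨ cong (suc (p + q) *_) ([p+q]Cp*p!*q!≡[p+q]! p q) ⟨
      suc (p + q) * (((p + q) C p) * (p ! * q !))   ≡⟨ *-assoc (suc (p + q)) ((p + q) C p) (p ! * q !) ⟨
      suc (p + q) * ((p + q) C p) * (p ! * q !)     ∎)
    where open ≡-Reasoning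

  [1+n]Cn≡1+n : ∀ n → suc n C n ≡ suc n
  [1+n]Cn≡1+n n = begin
    suc n C n              ≡⟨ nCk≡nC[n∸k] (n≤1+n n) ⟩
    suc n C (suc n ∸ n)    ≡⟨ cong (suc n C_) (m+n∸n≡m 1 n) ⟩
    suc n C 1              ≡⟨ nC1≡n (suc n) ⟩
    suc n                  ∎
    where open ≡-Reasoning

  [n+1]Cn≡1+n : ∀ n → (n + 1) C n ≡ suc n
  [n+1]Cn≡1+n n = trans (cong (_C n) (+-comm n 1)) ([1+n]Cn≡1+n n)

module Properties {c ℓ} (F : CharZeroField c ℓ) where
  open CharZeroField F
  open Binomials F
  open ℤ-Solver cring
  open import Algebra.Properties.CommutativeSemigroup *-commutativeSemigroup using (x∙yz≈y∙xz)
  open import Relation.Binary.Reasoning.Setoid setoid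

  ι-cong : ∀ {m n} → m ≡ n → ι m ≈ ι n
  ι-cong m≡n = reflexive (≡.cong ι m≡n)

  ι-split : ∀ n k → k ≤ n → ι n ≈ ι k + ι (n ∸ k)
  ι-split n k k≤n = trans (ι-cong (≡.sym (ℕ.m+[n∸m]≡n k≤n))) (fromℕ-+ k (n ∸ k))

  *-cancelˡ : ∀ {u v w} → ¬ u ≈ 0# → u * v ≈ u * w → v ≈ w
  *-cancelˡ {u} {v} {w} u≉0 uv≈uw = begin
    v                 ≈⟨ *-identityˡ v ⟨
    1# * v            ≈⟨ *-congʳ (trans (*-comm _ _) (inverse u u≉0)) ⟨
    (u ⁻¹ * u) * v    ≈⟨ *-assoc _ _ _ ⟩
    u ⁻¹ * (u * v)    ≈⟨ *-congˡ uv≈uw ⟩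
    u ⁻¹ * (u * w)    ≈⟨ *-assoc _ _ _ ⟨
    (u ⁻¹ * u) * w    ≈⟨ *-congʳ (trans (*-comm _ _) (inverse u u≉0)) ⟩
    1# * w            ≈⟨ *-identityˡ w ⟩
    w                 ∎

  *-≉0 : ∀ {u v} → ¬ u ≈ 0# → ¬ v ≈ 0# → ¬ u * v ≈ 0#
  *-≉0 {u} u≉0 v≉0 uv≈0 = v≉0 (*-cancelˡ u≉0 (trans uv≈0 (sym (zeroʳ u))))

  ⁻¹-≉0 : ∀ {u} → ¬ u ≈ 0# → ¬ u ⁻¹ ≈ 0#
  ⁻¹-≉0 {u} u≉0 u⁻¹≈0 = 0≉1 (begin
    0#          ≈⟨ zeroʳ u ⟨
    u * 0#      ≈⟨ *-congˡ u⁻¹≈0 ⟨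
    u * u ⁻¹    ≈⟨ inverse u u≉0 ⟩
    1#          ∎)

  ⁻¹-* : ∀ {u v} → ¬ u ≈ 0# → ¬ v ≈ 0# → (u * v) ⁻¹ ≈ u ⁻¹ * v ⁻¹
  ⁻¹-* {u} {v} u≉0 v≉0 = *-cancelˡ (*-≉0 u≉0 v≉0) (begin
    (u * v) * (u * v) ⁻¹          ≈⟨ inverse _ (*-≉0 u≉0 v≉0) ⟩
    1#                            ≈⟨ *-identityʳ 1# ⟨
    1# * 1#                       ≈⟨ *-cong (inverse u u≉0) (inverse v v≉0) ⟨
    (u * u ⁻¹) * (v * v ⁻¹)       ≈⟨ solve 4 (λ a b c d → (a :* b) :* (c :* d) := (a :* c) :* (b :* d)) refl _ _ _ _ ⟩
    (u * v) * (u ⁻¹ * v ⁻¹)       ∎)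

  ⁻¹-involutive : ∀ {u} → ¬ u ≈ 0# → (u ⁻¹) ⁻¹ ≈ u
  ⁻¹-involutive {u} u≉0 = *-cancelˡ (⁻¹-≉0 u≉0)
    (trans (inverse _ (⁻¹-≉0 u≉0)) (sym (trans (*-comm _ _) (inverse u u≉0))))

  fact≉0 : ∀ k → ¬ fact k ≈ 0#
  fact≉0 k with k ! | ℕ._!≢0 k
  ... | suc m | _ = char0 m

  fact-suc : ∀ k → fact (suc k) ≈ ι (suc k) * fact k
  fact-suc k = fromℕ-* (suc k) (k !)

  ι-suc*fact-suc⁻¹ : ∀ k → ι (suc k) * fact (suc k) ⁻¹ ≈ fact k ⁻¹
  ι-suc*fact-suc⁻¹ k = *-cancelˡ (fact≉0 k) (begin
    fact k * (ι (suc k) * fact (suc k) ⁻¹)    ≈⟨ *-assoc _ _ _ ⟨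
    fact k * ι (suc k) * fact (suc k) ⁻¹      ≈⟨ *-congʳ (trans (*-comm _ _) (sym (fact-suc k))) ⟩
    fact (suc k) * fact (suc k) ⁻¹            ≈⟨ inverse _ (fact≉0 (suc k)) ⟩
    1#                                        ≈⟨ inverse _ (fact≉0 k) ⟨
    fact k * fact k ⁻¹                        ∎)

  sumTo-cong : ∀ N {f g : ℕ → Carrier} → (∀ m → m ≤ N → f m ≈ g m) → sumTo N f ≈ sumTo N g
  sumTo-cong zero f≈g = f≈g 0 z≤n
  sumTo-cong (suc N) f≈g =
    +-cong (sumTo-cong N (λ m m≤N → f≈g m (ℕ.m≤n⇒m≤1+n m≤N))) (f≈g (suc N) ℕ.≤-refl)

  sumTo-+ : ∀ N (f g : ℕ → Carrier) → sumTo N (λ m → f m + g m) ≈ sumTo N f + sumTo N g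
  sumTo-+ zero f g = refl
  sumTo-+ (suc N) f g = trans (+-congʳ (sumTo-+ N f g))
    (solve 4 (λ a b c d → (a :+ b) :+ (c :+ d) := (a :+ c) :+ (b :+ d)) refl _ _ _ _)

  *-distribˡ-sumTo : ∀ N k (f : ℕ → Carrier) → k * sumTo N f ≈ sumTo N (λ m → k * f m)
  *-distribˡ-sumTo zero k f = refl
  *-distribˡ-sumTo (suc N) k f = trans (distribˡ _ _ _) (+-congʳ (*-distribˡ-sumTo N k f))

  sumTo-suc-shift : ∀ N (f : ℕ → Carrier) → sumTo (suc N) f ≈ f 0 + sumTo N (λ m → f (suc m))
  sumTo-suc-shift zero f = refl
  sumTo-suc-shift (suc N) f = trans (+-congʳ (sumTo-suc-shift N f)) (+-assoc _ _ _)

  sumTo-suc-≈0 : ∀ N (f : ℕ → Carrier) → f (suc N) ≈ 0# → sumTo (suc N) f ≈ sumTo N f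
  sumTo-suc-≈0 N f f[1+N]≈0 = trans (+-congˡ f[1+N]≈0) (+-identityʳ _)

  rising : Carrier → ℕ → Carrier
  rising a zero = 1#
  rising a (suc k) = rising a k * (a + ι k)

  rising-cong : ∀ {a b} k → a ≈ b → rising a k ≈ rising b k
  rising-cong zero a≈b = refl
  rising-cong (suc k) a≈b = *-cong (rising-cong k a≈b) (+-congʳ a≈b)

  rising-suc : ∀ a k → rising a (suc k) ≈ a * rising (a + 1#) k
  rising-suc a zero = solve 1 (λ a → con (+ 1) :* (a :+ con (+ 0)) := a :* con (+ 1)) refl a
  rising-suc a (suc k) = begin
    rising a (suc k) * (a + (1# + ι k))       ≈⟨ *-congʳ (rising-suc a k) ⟩
    a * rising (a + 1#) k * (a + (1# + ι k))  ≈⟨ solve 3 (λ a r k → a :* r :* (a :+ (con (+ 1) :+ k)) := a :* (r :* (a :+ con (+ 1) :+ k))) refl a (rising (a + 1#) k) (ι k) ⟩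
    a * rising (a + 1#) (suc k)               ∎

  falling-cong : ∀ {a b} k → a ≈ b → falling a k ≈ falling b k
  falling-cong zero a≈b = refl
  falling-cong (suc k) a≈b = *-cong (falling-cong k a≈b) (+-congʳ a≈b)

  falling-suc : ∀ a k → falling (a + 1#) (suc k) ≈ (a + 1#) * falling a k
  falling-suc a zero = solve 1 (λ a → con (+ 1) :* ((a :+ con (+ 1)) :- con (+ 0)) := (a :+ con (+ 1)) :* con (+ 1)) refl a
  falling-suc a (suc k) = begin
    falling (a + 1#) (suc k) * (a + 1# - (1# + ι k))     ≈⟨ *-congʳ (falling-suc a k) ⟩
    (a + 1#) * falling a k * (a + 1# - (1# + ι k))       ≈⟨ solve 3 (λ a f k → (a :+ con (+ 1)) :* f :* (a :+ con (+ 1) :- (con (+ 1) :+ k)) := (a :+ con (+ 1)) :* (f :* (a :- k))) refl a (falling a k) (ι k) ⟩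
    (a + 1#) * falling a (suc k)                         ∎

  falling-+ : ∀ a j k → falling a (j ℕ.+ k) ≈ falling a j * falling (a - ι j) k
  falling-+ a j zero = trans (reflexive (≡.cong (falling a) (ℕ.+-identityʳ j))) (sym (*-identityʳ _))
  falling-+ a j (suc k) = begin
    falling a (j ℕ.+ suc k)                               ≈⟨ reflexive (≡.cong (falling a) (ℕ.+-suc j k)) ⟩
    falling a (j ℕ.+ k) * (a - ι (j ℕ.+ k))               ≈⟨ *-cong (falling-+ a j k) (+-congˡ (-‿cong (fromℕ-+ j k))) ⟩
    falling a j * falling (a - ι j) k * (a - (ι j + ι k)) ≈⟨ solve 5 (λ f g a j k → f :* g :* (a :- (j :+ k)) := f :* (g :* ((a :- j) :- k))) refl _ _ a (ι j) (ι k) ⟩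
    falling a j * falling (a - ι j) (suc k)               ∎

  falling≈rising : ∀ a j → falling (a + ι j) j ≈ rising (a + 1#) j
  falling≈rising a zero = refl
  falling≈rising a (suc j) = begin
    falling (a + (1# + ι j)) (suc j)     ≈⟨ falling-cong (suc j) (solve 2 (λ a j → a :+ (con (+ 1) :+ j) := (a :+ j) :+ con (+ 1)) refl a (ι j)) ⟩
    falling (a + ι j + 1#) (suc j)       ≈⟨ falling-suc (a + ι j) j ⟩
    (a + ι j + 1#) * falling (a + ι j) j ≈⟨ *-congˡ (falling≈rising a j) ⟩
    (a + ι j + 1#) * rising (a + 1#) j   ≈⟨ solve 3 (λ a j r → (a :+ j :+ con (+ 1)) :* r := r :* (a :+ con (+ 1) :+ j)) refl a (ι j) (rising (a + 1#) j) ⟩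
    rising (a + 1#) (suc j)              ∎

  binom-zero : ∀ a → binom a 0 ≈ 1#
  binom-zero a = trans (*-identityˡ _) (*-cancelˡ (char0 0)
    (trans (inverse (ι 1) (char0 0)) (sym (trans (*-identityʳ _) (+-identityʳ 1#)))))

  ι-suc*binom-suc : ∀ a j → ι (suc j) * binom a (suc j) ≈ (a - ι j) * binom a j
  ι-suc*binom-suc a j = begin
    ι (suc j) * (falling a j * (a - ι j) * fact (suc j) ⁻¹)   ≈⟨ solve 4 (λ i f b u → i :* (f :* b :* u) := b :* (f :* (i :* u))) refl (ι (suc j)) _ _ _ ⟩
    (a - ι j) * (falling a j * (ι (suc j) * fact (suc j) ⁻¹)) ≈⟨ *-congˡ (*-congˡ (ι-suc*fact-suc⁻¹ j)) ⟩
    (a - ι j) * binom a j                                     ∎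

  ι-suc*binom-suc-shifted : ∀ a k →
    ι (suc k) * binom (a + ι (suc k)) (suc k) ≈ (a + ι (suc k)) * binom (a + ι k) k
  ι-suc*binom-suc-shifted a k = begin
    ι (suc k) * (falling (a + ι (suc k)) (suc k) * fact (suc k) ⁻¹)
      ≈⟨ *-congˡ (*-congʳ (trans (falling-cong (suc k) (solve 2 (λ a k → a :+ (con (+ 1) :+ k) := (a :+ k) :+ con (+ 1)) refl a (ι k))) (falling-suc (a + ι k) k))) ⟩
    ι (suc k) * ((a + ι k + 1#) * falling (a + ι k) k * fact (suc k) ⁻¹)
      ≈⟨ solve 5 (λ i k f u a → i :* ((a :+ k :+ con (+ 1)) :* f :* u) := (a :+ (con (+ 1) :+ k)) :* (f :* (i :* u))) refl (ι (suc k)) (ι k) _ _ a ⟩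
    (a + ι (suc k)) * (falling (a + ι k) k * (ι (suc k) * fact (suc k) ⁻¹))
      ≈⟨ *-congˡ (*-congˡ (ι-suc*fact-suc⁻¹ k)) ⟩
    (a + ι (suc k)) * binom (a + ι k) k
      ∎

  ι-C≈fact-ratio : ∀ m j → ι ((m ℕ.+ j) C m) ≈ fact (m ℕ.+ j) * fact m ⁻¹ * fact j ⁻¹
  ι-C≈fact-ratio m j = sym (begin
    fact (m ℕ.+ j) * fact m ⁻¹ * fact j ⁻¹
      ≈⟨ *-congʳ (*-congʳ (ι-cong ([p+q]Cp*p!*q!≡[p+q]! m j))) ⟨
    ι (((m ℕ.+ j) C m) ℕ.* (m ! ℕ.* j !)) * fact m ⁻¹ * fact j ⁻¹
      ≈⟨ *-congʳ (*-congʳ (trans (fromℕ-* ((m ℕ.+ j) C m) (m ! ℕ.* j !)) (*-congˡ (fromℕ-* (m !) (j !))))) ⟩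
    ι ((m ℕ.+ j) C m) * (fact m * fact j) * fact m ⁻¹ * fact j ⁻¹
      ≈⟨ solve 5 (λ c a b a′ b′ → c :* (a :* b) :* a′ :* b′ := c :* (a :* a′) :* (b :* b′)) refl _ _ _ _ _ ⟩
    ι ((m ℕ.+ j) C m) * (fact m * fact m ⁻¹) * (fact j * fact j ⁻¹)
      ≈⟨ *-cong (*-congˡ (inverse _ (fact≉0 m))) (inverse _ (fact≉0 j)) ⟩
    ι ((m ℕ.+ j) C m) * 1# * 1#
      ≈⟨ trans (*-identityʳ _) (*-identityʳ _) ⟩
    ι ((m ℕ.+ j) C m)
      ∎)

  ι-C-suc-top : ∀ p q → ι ((p ℕ.+ suc q) C p) * ι (suc q) ≈ (1# + (ι p + ι q)) * ι ((p ℕ.+ q) C p)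
  ι-C-suc-top p q = begin
    ι ((p ℕ.+ suc q) C p) * ι (suc q) ≈⟨ sym (fromℕ-* ((p ℕ.+ suc q) C p) (suc q)) ⟩
    ι (((p ℕ.+ suc q) C p) ℕ.* suc q) ≈⟨ ι-cong ([p+1+q]Cp*[1+q]≡[1+p+q]*[p+q]Cp p q) ⟩
    ι (suc (p ℕ.+ q) ℕ.* ((p ℕ.+ q) C p)) ≈⟨ fromℕ-* (suc (p ℕ.+ q)) ((p ℕ.+ q) C p) ⟩
    (1# + ι (p ℕ.+ q)) * ι ((p ℕ.+ q) C p) ≈⟨ *-congʳ (+-congˡ (fromℕ-+ p q)) ⟩
    (1# + (ι p + ι q)) * ι ((p ℕ.+ q) C p) ∎

  ι-C-suc-suc : ∀ p q → ι ((suc (p ℕ.+ q)) C (suc p)) * ι (suc p) ≈ (1# + (ι p + ι q)) * ι ((p ℕ.+ q) C p)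
  ι-C-suc-suc p q = begin
    ι ((suc (p ℕ.+ q)) C (suc p)) * ι (suc p) ≈⟨ sym (fromℕ-* ((suc (p ℕ.+ q)) C (suc p)) (suc p)) ⟩
    ι (((suc (p ℕ.+ q)) C (suc p)) ℕ.* suc p) ≈⟨ ι-cong ([1+p+q]C[1+p]*[1+p]≡[1+p+q]*[p+q]Cp p q) ⟩
    ι (suc (p ℕ.+ q) ℕ.* ((p ℕ.+ q) C p)) ≈⟨ fromℕ-* (suc (p ℕ.+ q)) ((p ℕ.+ q) C p) ⟩
    (1# + ι (p ℕ.+ q)) * ι ((p ℕ.+ q) C p) ≈⟨ *-congʳ (+-congˡ (fromℕ-+ p q)) ⟩
    (1# + (ι p + ι q)) * ι ((p ℕ.+ q) C p) ∎

  -- The recurrence for n! dₙ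

  module Point (r x : Carrier) where

    ρ A : Carrier
    ρ = ι 2 * r
    A = ι 2 * x + 1#

    e : ℕ → Carrier
    e n = ι (suc n) * (ρ + ι (suc n))

    u : ℕ → ℕ → Carrier
    u k j = binom (x + r + ι k) k * binom (x - r) j

    imbalance : ℕ → Carrier
    imbalance n = sumTo n (λ k → (ι k - ι (n ∸ k)) * u k (n ∸ k))

    sumTo-ι*u : ∀ n →
      sumTo (suc n) (λ k → ι k * u k (suc n ∸ k)) ≈ sumTo n (λ k → (x + r + ι (suc k)) * u k (n ∸ k))
    sumTo-ι*u n = begin
      sumTo (suc n) (λ k → ι k * u k (suc n ∸ k))
        ≈⟨ sumTo-suc-shift n _ ⟩
      0# * u 0 (suc n) + sumTo n (λ k → ι (suc k) * u (suc k) (n ∸ k))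
        ≈⟨ trans (+-congʳ (zeroˡ _)) (+-identityˡ _) ⟩
      sumTo n (λ k → ι (suc k) * u (suc k) (n ∸ k))
        ≈⟨ sumTo-cong n (λ k _ → trans (sym (*-assoc _ _ _)) (trans (*-congʳ (ι-suc*binom-suc-shifted (x + r) k)) (*-assoc _ _ _))) ⟩
      sumTo n (λ k → (x + r + ι (suc k)) * u k (n ∸ k))
        ∎

    sumTo-ι∸*u : ∀ n →
      sumTo (suc n) (λ k → ι (suc n ∸ k) * u k (suc n ∸ k)) ≈ sumTo n (λ k → (x - r - ι (n ∸ k)) * u k (n ∸ k))
    sumTo-ι∸*u n = begin
      sumTo (suc n) (λ k → ι (suc n ∸ k) * u k (suc n ∸ k)) ≈⟨ sumTo-suc-≈0 n _ last≈0 ⟩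
      sumTo n (λ k → ι (suc n ∸ k) * u k (suc n ∸ k))       ≈⟨ sumTo-cong n step ⟩
      sumTo n (λ k → (x - r - ι (n ∸ k)) * u k (n ∸ k))     ∎
      where
      last≈0 : ι (n ∸ n) * u (suc n) (n ∸ n) ≈ 0#
      last≈0 rewrite ℕ.n∸n≡0 n = zeroˡ _
      step : ∀ k → k ≤ n → ι (suc n ∸ k) * u k (suc n ∸ k) ≈ (x - r - ι (n ∸ k)) * u k (n ∸ k)
      step k k≤n rewrite ℕ.+-∸-assoc 1 k≤n =
        trans (x∙yz≈y∙xz _ _ _) (trans (*-congˡ (ι-suc*binom-suc (x - r) (n ∸ k))) (x∙yz≈y∙xz _ _ _))

    ι-suc*d-suc : ∀ n → ι (suc n) * d (suc n) r x ≈ A * d n r x + imbalance n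
    ι-suc*d-suc n = begin
      ι (suc n) * d (suc n) r x
        ≈⟨ *-distribˡ-sumTo (suc n) (ι (suc n)) _ ⟩
      sumTo (suc n) (λ k → ι (suc n) * u k (suc n ∸ k))
        ≈⟨ sumTo-cong (suc n) (λ k k≤ → trans (*-congʳ (ι-split (suc n) k k≤)) (distribʳ _ _ _)) ⟩
      sumTo (suc n) (λ k → ι k * u k (suc n ∸ k) + ι (suc n ∸ k) * u k (suc n ∸ k))
        ≈⟨ trans (sumTo-+ (suc n) _ _) (+-cong (sumTo-ι*u n) (sumTo-ι∸*u n)) ⟩
      sumTo n (λ k → (x + r + ι (suc k)) * u k (n ∸ k)) + sumTo n (λ k → (x - r - ι (n ∸ k)) * u k (n ∸ k))
        ≈⟨ sumTo-+ n _ _ ⟨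
      sumTo n (λ k → (x + r + ι (suc k)) * u k (n ∸ k) + (x - r - ι (n ∸ k)) * u k (n ∸ k))
        ≈⟨ sumTo-cong n (λ k _ → solve 5 (λ x r K J U → (x :+ r :+ (con (+ 1) :+ K)) :* U :+ (x :- r :- J) :* U := (con (+ 2) :* x :+ con (+ 1)) :* U :+ (K :- J) :* U) refl x r (ι k) (ι (n ∸ k)) (u k (n ∸ k))) ⟩
      sumTo n (λ k → A * u k (n ∸ k) + (ι k - ι (n ∸ k)) * u k (n ∸ k))
        ≈⟨ trans (sumTo-+ n _ _) (+-congʳ (sym (*-distribˡ-sumTo n A _))) ⟩
      A * d n r x + imbalance n
        ∎

    imbalance-suc : ∀ n → imbalance (suc n) ≈ (ρ + ι (suc n)) * d n r x
    imbalance-suc n = begin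
      imbalance (suc n)
        ≈⟨ sumTo-cong (suc n) (λ k _ → solve 3 (λ K J U → (K :- J) :* U := K :* U :+ (:- con (+ 1)) :* (J :* U)) refl (ι k) (ι (suc n ∸ k)) (u k (suc n ∸ k))) ⟩
      sumTo (suc n) (λ k → ι k * u k (suc n ∸ k) + - 1# * (ι (suc n ∸ k) * u k (suc n ∸ k)))
        ≈⟨ sumTo-+ (suc n) _ _ ⟩
      sumTo (suc n) (λ k → ι k * u k (suc n ∸ k)) + sumTo (suc n) (λ k → - 1# * (ι (suc n ∸ k) * u k (suc n ∸ k)))
        ≈⟨ +-cong (sumTo-ι*u n) (trans (sym (*-distribˡ-sumTo (suc n) (- 1#) _)) (trans (*-congˡ (sumTo-ι∸*u n)) (*-distribˡ-sumTo n (- 1#) _))) ⟩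
      sumTo n (λ k → (x + r + ι (suc k)) * u k (n ∸ k)) + sumTo n (λ k → - 1# * ((x - r - ι (n ∸ k)) * u k (n ∸ k)))
        ≈⟨ sumTo-+ n _ _ ⟨
      sumTo n (λ k → (x + r + ι (suc k)) * u k (n ∸ k) + - 1# * ((x - r - ι (n ∸ k)) * u k (n ∸ k)))
        ≈⟨ sumTo-cong n (λ k k≤n → trans (solve 5 (λ x r K J U → (x :+ r :+ (con (+ 1) :+ K)) :* U :+ (:- con (+ 1)) :* ((x :- r :- J) :* U) := (con (+ 2) :* r :+ (con (+ 1) :+ (K :+ J))) :* U) refl x r (ι k) (ι (n ∸ k)) (u k (n ∸ k)))
                                           (*-congʳ (+-congˡ (+-congˡ (sym (ι-split n k k≤n)))))) ⟩
      sumTo n (λ k → (ρ + ι (suc n)) * u k (n ∸ k))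
        ≈⟨ *-distribˡ-sumTo n _ _ ⟨
      (ρ + ι (suc n)) * d n r x
        ∎

    d̂ : ℕ → Carrier
    d̂ n = fact n * d n r x

    d-zero : d 0 r x ≈ 1#
    d-zero = trans (*-cong (binom-zero (x + r + ι 0)) (binom-zero (x - r))) (*-identityʳ 1#)

    d̂-zero : d̂ 0 ≈ 1#
    d̂-zero = trans (*-cong (+-identityʳ 1#) d-zero) (*-identityˡ 1#)

    d̂-one : d̂ 1 ≈ A
    d̂-one = begin
      ι 1 * d 1 r x             ≈⟨ ι-suc*d-suc 0 ⟩
      A * d 0 r x + imbalance 0 ≈⟨ +-cong (trans (*-congˡ d-zero) (*-identityʳ A)) (trans (*-congʳ (-‿inverseʳ 0#)) (zeroˡ _)) ⟩
      A + 0#                    ≈⟨ +-identityʳ A ⟩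
      A                         ∎

    d̂-suc-suc : ∀ n → d̂ (suc (suc n)) ≈ A * d̂ (suc n) + e n * d̂ n
    d̂-suc-suc n = begin
      fact (suc (suc n)) * d (suc (suc n)) r x
        ≈⟨ *-congʳ (fact-suc (suc n)) ⟩
      ι (suc (suc n)) * fact (suc n) * d (suc (suc n)) r x
        ≈⟨ solve 3 (λ a b c → a :* b :* c := b :* (a :* c)) refl _ _ _ ⟩
      fact (suc n) * (ι (suc (suc n)) * d (suc (suc n)) r x)
        ≈⟨ *-congˡ (trans (ι-suc*d-suc (suc n)) (+-congˡ (imbalance-suc n))) ⟩
      fact (suc n) * (A * d (suc n) r x + (ρ + ι (suc n)) * d n r x)
        ≈⟨ solve 4 (λ f a d b → f :* (a :* d :+ b) := a :* (f :* d) :+ f :* b) refl (fact (suc n)) A (d (suc n) r x) ((ρ + ι (suc n)) * d n r x) ⟩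
      A * d̂ (suc n) + fact (suc n) * ((ρ + ι (suc n)) * d n r x)
        ≈⟨ +-congˡ (*-congʳ (fact-suc n)) ⟩
      A * d̂ (suc n) + ι (suc n) * fact n * ((ρ + ι (suc n)) * d n r x)
        ≈⟨ +-congˡ (solve 4 (λ i f b d → i :* f :* (b :* d) := i :* b :* (f :* d)) refl _ _ _ _) ⟩
      A * d̂ (suc n) + e n * d̂ n
        ∎

    -- The sum side

    Φ : ℕ → Carrier
    Φ m = falling (x - r) m * falling (x + r + ι m) m

    γ : ℕ → Carrier
    γ m = (ρ + ι (suc (m ℕ.+ m))) * (ρ + ι (suc (m ℕ.+ m)))

    Φ-suc : ∀ m → Φ (suc m) ≈ Φ m * ((x - r - ι m) * (x + r + ι m + 1#))
    Φ-suc m = begin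
      falling (x - r) m * (x - r - ι m) * falling (x + r + (1# + ι m)) (suc m)
        ≈⟨ *-congˡ (falling-cong (suc m) (solve 3 (λ x r m → x :+ r :+ (con (+ 1) :+ m) := x :+ r :+ m :+ con (+ 1)) refl x r (ι m))) ⟩
      falling (x - r) m * (x - r - ι m) * falling (x + r + ι m + 1#) (suc m)
        ≈⟨ *-congˡ (falling-suc (x + r + ι m) m) ⟩
      falling (x - r) m * (x - r - ι m) * ((x + r + ι m + 1#) * falling (x + r + ι m) m)
        ≈⟨ solve 4 (λ a u v b → a :* u :* (v :* b) := a :* b :* (u :* v)) refl _ _ _ _ ⟩
      Φ m * ((x - r - ι m) * (x + r + ι m + 1#))
        ∎

    -- (2x+1)² = 4 (x-r-m)(x+r+m+1) + (2r+2m+1)²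
    A*A*Φ : ∀ m → A * A * Φ m ≈ ι 4 * Φ (suc m) + γ m * Φ m
    A*A*Φ m = begin
      A * A * Φ m
        ≈⟨ solve 4 (λ x r M f → (con (+ 2) :* x :+ con (+ 1)) :* (con (+ 2) :* x :+ con (+ 1)) :* f
                     := con (+ 4) :* (f :* ((x :- r :- M) :* (x :+ r :+ M :+ con (+ 1))))
                        :+ (con (+ 2) :* r :+ (con (+ 1) :+ (M :+ M))) :* (con (+ 2) :* r :+ (con (+ 1) :+ (M :+ M))) :* f)
                   refl x r (ι m) (Φ m) ⟩
      ι 4 * (Φ m * ((x - r - ι m) * (x + r + ι m + 1#))) + (ρ + (1# + (ι m + ι m))) * (ρ + (1# + (ι m + ι m))) * Φ m
        ≈⟨ +-cong (*-congˡ (sym (Φ-suc m))) (*-congʳ (*-cong 2m+1≈ 2m+1≈)) ⟩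
      ι 4 * Φ (suc m) + γ m * Φ m
        ∎
      where
      2m+1≈ : ρ + (1# + (ι m + ι m)) ≈ ρ + ι (suc (m ℕ.+ m))
      2m+1≈ = +-congˡ (+-congˡ (sym (fromℕ-+ m m)))

    series : ℕ → (ℕ → Carrier) → Carrier
    series N h = sumTo N (λ m → pow (ι 4) m * Φ m * h m)

    series-cong : ∀ N {h h′ : ℕ → Carrier} → (∀ m → m ≤ N → h m ≈ h′ m) → series N h ≈ series N h′
    series-cong N h≈h′ = sumTo-cong N (λ m m≤N → *-congˡ (h≈h′ m m≤N))

    series-suc-≈0 : ∀ N (h : ℕ → Carrier) → h (suc N) ≈ 0# → series (suc N) h ≈ series N h
    series-suc-≈0 N h h[1+N]≈0 = sumTo-suc-≈0 N _ (trans (*-congˡ h[1+N]≈0) (zeroʳ _))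

    series-+-* : ∀ N k (f g : ℕ → Carrier) → series N f + k * series N g ≈ series N (λ m → f m + k * g m)
    series-+-* N k f g = begin
      series N f + k * series N g
        ≈⟨ +-congˡ (trans (*-distribˡ-sumTo N k _) (sumTo-cong N (λ m _ → solve 4 (λ k p f h → k :* (p :* f :* h) := p :* f :* (k :* h)) refl k _ _ _))) ⟩
      series N f + series N (λ m → k * g m)
        ≈⟨ sumTo-+ N _ _ ⟨
      sumTo N (λ m → pow (ι 4) m * Φ m * f m + pow (ι 4) m * Φ m * (k * g m))
        ≈⟨ sumTo-cong N (λ m _ → sym (distribˡ _ _ _)) ⟩
      series N (λ m → f m + k * g m)
        ∎

    shift : (ℕ → Carrier) → ℕ → Carrier
    shift h zero = 0#
    shift h (suc m) = h m

    A*A*series : ∀ N h → h (suc N) ≈ 0# → A * A * series N h ≈ series (suc N) (λ m → shift h m + γ m * h m)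
    A*A*series N h h[1+N]≈0 = begin
      A * A * series N h
        ≈⟨ *-distribˡ-sumTo N (A * A) _ ⟩
      sumTo N (λ m → A * A * (pow (ι 4) m * Φ m * h m))
        ≈⟨ sumTo-cong N (λ m _ → term-A*A m) ⟩
      sumTo N (λ m → f (suc m) + g m)
        ≈⟨ sumTo-+ N _ g ⟩
      sumTo N (λ m → f (suc m)) + sumTo N g
        ≈⟨ +-cong (trans (+-congʳ (zeroʳ _)) (+-identityˡ _)) (series-suc-≈0 N (λ m → γ m * h m) (trans (*-congˡ h[1+N]≈0) (zeroʳ _))) ⟨
      (pow (ι 4) 0 * Φ 0 * 0# + sumTo N (λ m → f (suc m))) + series (suc N) (λ m → γ m * h m)
        ≈⟨ +-congʳ (sumTo-suc-shift N f) ⟨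
      sumTo (suc N) f + sumTo (suc N) g
        ≈⟨ sumTo-+ (suc N) f g ⟨
      sumTo (suc N) (λ m → f m + g m)
        ≈⟨ sumTo-cong (suc N) (λ m _ → sym (distribˡ _ _ _)) ⟩
      series (suc N) (λ m → shift h m + γ m * h m)
        ∎
      where
      f g : ℕ → Carrier
      f m = pow (ι 4) m * Φ m * shift h m
      g m = pow (ι 4) m * Φ m * (γ m * h m)
      term-A*A : ∀ m → A * A * (pow (ι 4) m * Φ m * h m) ≈ f (suc m) + g m
      term-A*A m = begin
        A * A * (pow (ι 4) m * Φ m * h m)
          ≈⟨ solve 4 (λ a p f h → a :* (p :* f :* h) := p :* (a :* f) :* h) refl (A * A) _ _ _ ⟩
        pow (ι 4) m * (A * A * Φ m) * h m
          ≈⟨ *-congʳ (*-congˡ (A*A*Φ m)) ⟩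
        pow (ι 4) m * (ι 4 * Φ (suc m) + γ m * Φ m) * h m
          ≈⟨ solve 6 (λ p f4 g f c h → p :* (f4 :* g :+ c :* f) :* h := p :* f4 :* g :* h :+ p :* f :* (c :* h)) refl _ _ _ _ _ _ ⟩
        f (suc m) + g m
          ∎

    P Q : ℕ → ℕ → Carrier
    P m j = rising (ρ + ι (suc m)) j * rising (ρ + ι (suc (m ℕ.+ m))) j
    Q m j = rising (ρ + ι (suc m)) j * rising (ρ + ι (suc (suc (m ℕ.+ m)))) j

    σ ω : ℕ → ℕ → Carrier
    σ n m = ι (n C m) * P m (n ∸ m)
    ω n m = ι (n C m) * Q m (n ∸ m)

    σ-vanishes : ∀ n m → n < m → σ n m ≈ 0#
    σ-vanishes n m n<m rewrite k>n⇒nCk≡0 {n} {m} n<m = zeroˡ _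

    ω-vanishes : ∀ n m → n < m → ω n m ≈ 0#
    ω-vanishes n m n<m rewrite k>n⇒nCk≡0 {n} {m} n<m = zeroˡ _

    σ-unfold : ∀ n m j → n ≡ m ℕ.+ j → σ n m ≈ ι ((m ℕ.+ j) C m) * P m j
    σ-unfold n m j eq rewrite eq | ℕ.m+n∸m≡n m j = refl

    ω-unfold : ∀ n m j → n ≡ m ℕ.+ j → ω n m ≈ ι ((m ℕ.+ j) C m) * Q m j
    ω-unfold n m j eq rewrite eq | ℕ.m+n∸m≡n m j = refl

    ω-Recurrence : ℕ → ℕ → Set ℓ
    ω-Recurrence n m = ω (suc n) m ≈ σ (suc n) m + e n * ω n m

    -- Multiplying by i+1 makes both binomial coefficients multiples of C(m+i, m).
    ω-recurrence-interior : ∀ m i → ω-Recurrence (m ℕ.+ i) m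
    ω-recurrence-interior m i = begin
      ω (suc (m ℕ.+ i)) m
        ≈⟨ ω-unfold _ m (suc i) (≡.sym (ℕ.+-suc m i)) ⟩
      b * Q m (suc i)
        ≈⟨ *-congˡ Q-suc≈ ⟩
      b * (U * Z * (ρ + (1# + M) + I) * (ρ + (1# + (1# + (M + M))) + I))
        ≈⟨ cancel-rescaled (char0 i) (ι-C-suc-top m i) cleared ⟩
      b * (U * Z * (ρ + (1# + M) + I) * (ρ + (1# + (M + M)))) + E * (G * (U * Z))
        ≈⟨ +-cong (trans (σ-unfold _ m (suc i) (≡.sym (ℕ.+-suc m i))) (*-congˡ P-suc≈)) (*-cong e≈E (ω-unfold _ m i ≡.refl)) ⟨
      σ (suc (m ℕ.+ i)) m + e (m ℕ.+ i) * ω (m ℕ.+ i) m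
        ∎
      where
      cancel-rescaled : ∀ {b t K X1 X2 Y} → ¬ (t ≈ 0#) → b * t ≈ K → K * X1 ≈ K * X2 + t * Y → b * X1 ≈ b * X2 + Y
      cancel-rescaled {b} {t} {K} {X1} {X2} {Y} t≉0 b*t≈K K-identity = *-cancelˡ t≉0 (begin
        t * (b * X1) ≈⟨ sym (*-assoc _ _ _) ⟩
        t * b * X1 ≈⟨ *-congʳ (trans (*-comm t b) b*t≈K) ⟩
        K * X1 ≈⟨ K-identity ⟩
        K * X2 + t * Y ≈⟨ +-congʳ (*-congʳ (sym (trans (*-comm t b) b*t≈K))) ⟩
        t * b * X2 + t * Y ≈⟨ +-congʳ (*-assoc _ _ _) ⟩
        t * (b * X2) + t * Y ≈⟨ sym (distribˡ _ _ _) ⟩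
        t * (b * X2 + Y) ∎)
      M I b G U Z E ρ+2m+1 : Carrier
      M = ι m
      I = ι i
      b = ι ((m ℕ.+ suc i) C m)
      G = ι ((m ℕ.+ i) C m)
      U = rising (ρ + ι (suc m)) i
      Z = rising (ρ + ι (suc (suc (m ℕ.+ m)))) i
      E = (1# + (M + I)) * (ρ + (1# + (M + I)))
      ρ+2m+1 = ρ + ι (suc (m ℕ.+ m))
      e≈E : e (m ℕ.+ i) ≈ E
      e≈E = *-cong (+-congˡ (fromℕ-+ m i)) (+-congˡ (+-congˡ (fromℕ-+ m i)))
      ι[m+m]≈ : ι (m ℕ.+ m) ≈ M + M
      ι[m+m]≈ = fromℕ-+ m m
      Q-suc≈ : Q m (suc i) ≈ U * Z * (ρ + (1# + M) + I) * (ρ + (1# + (1# + (M + M))) + I)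
      Q-suc≈ = trans (solve 4 (λ u a z b → (u :* a) :* (z :* b) := u :* z :* a :* b) refl _ _ _ _)
                 (*-congˡ (+-congʳ (+-congˡ (+-congˡ (+-congˡ ι[m+m]≈)))))
      P-suc≈ : P m (suc i) ≈ U * Z * (ρ + (1# + M) + I) * (ρ + (1# + (M + M)))
      P-suc≈ = begin
        rising (ρ + ι (suc m)) (suc i) * rising ρ+2m+1 (suc i) ≈⟨ *-congˡ (rising-suc ρ+2m+1 i) ⟩
        (U * (ρ + (1# + M) + I)) * (ρ+2m+1 * rising (ρ+2m+1 + 1#) i) ≈⟨ *-congˡ (*-congˡ (rising-cong i (solve 2 (λ p k → p :+ (con (+ 1) :+ k) :+ con (+ 1) := p :+ (con (+ 1) :+ (con (+ 1) :+ k))) refl ρ (ι (m ℕ.+ m))))) ⟩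
        (U * (ρ + (1# + M) + I)) * (ρ+2m+1 * Z) ≈⟨ solve 4 (λ u a c z → (u :* a) :* (c :* z) := u :* z :* a :* c) refl _ _ _ _ ⟩
        U * Z * (ρ + (1# + M) + I) * ρ+2m+1 ≈⟨ *-congˡ (+-congˡ (+-congˡ ι[m+m]≈)) ⟩
        U * Z * (ρ + (1# + M) + I) * (ρ + (1# + (M + M))) ∎
      cleared : ((1# + (M + I)) * G) * (U * Z * (ρ + (1# + M) + I) * (ρ + (1# + (1# + (M + M))) + I))
           ≈ ((1# + (M + I)) * G) * (U * Z * (ρ + (1# + M) + I) * (ρ + (1# + (M + M)))) + ι (suc i) * (E * (G * (U * Z)))
      cleared = solve 6 (λ M I G U Z p →
           ((con (+ 1) :+ (M :+ I)) :* G) :* (U :* Z :* (p :+ (con (+ 1) :+ M) :+ I) :* (p :+ (con (+ 1) :+ (con (+ 1) :+ (M :+ M))) :+ I))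
        := ((con (+ 1) :+ (M :+ I)) :* G) :* (U :* Z :* (p :+ (con (+ 1) :+ M) :+ I) :* (p :+ (con (+ 1) :+ (M :+ M)))) :+ (con (+ 1) :+ I) :* (((con (+ 1) :+ (M :+ I)) :* (p :+ (con (+ 1) :+ (M :+ I)))) :* (G :* (U :* Z))))
        refl M I G U Z ρ

    ω-recurrence : ∀ n m → m ≤ suc n → ω-Recurrence n m
    ω-recurrence n m m≤1+n with ℕ.m≤n⇒m<n∨m≡n m≤1+n
    ... | inj₁ (s≤s m≤n) with ℕ.m≤n⇒∃[o]m+o≡n m≤n
    ...   | i , eq = ≡.subst (λ n → ω-Recurrence n m) eq (ω-recurrence-interior m i)
    ω-recurrence n m m≤1+n | inj₂ ≡.refl rewrite ℕ.n∸n≡0 n =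
      sym (trans (+-congˡ (trans (*-congˡ (ω-vanishes n (suc n) (ℕ.n<1+n n))) (zeroʳ _))) (+-identityʳ _))

    σ-recurrence-one : ∀ m → m ≤ 1 → σ 1 m ≈ shift (σ 0) m + γ m * σ 0 m
    σ-recurrence-one zero _ = solve 1 (λ p →
        (con (+ 1) :+ con (+ 0)) :* ((con (+ 1) :* ((p :+ (con (+ 1) :+ con (+ 0))) :+ con (+ 0))) :* (con (+ 1) :* ((p :+ (con (+ 1) :+ con (+ 0))) :+ con (+ 0))))
      := con (+ 0) :+ ((p :+ (con (+ 1) :+ con (+ 0))) :* (p :+ (con (+ 1) :+ con (+ 0)))) :* ((con (+ 1) :+ con (+ 0)) :* (con (+ 1) :* con (+ 1)))) refl ρ
    σ-recurrence-one (suc zero) _ = solve 1 (λ c →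
        (con (+ 1) :+ con (+ 0)) :* (con (+ 1) :* con (+ 1))
      := (con (+ 1) :+ con (+ 0)) :* (con (+ 1) :* con (+ 1)) :+ c :* (con (+ 0) :* (con (+ 1) :* con (+ 1)))) refl (γ 1)
    σ-recurrence-one (suc (suc m)) (s≤s ())

    σ-Recurrence : ℕ → ℕ → Set ℓ
    σ-Recurrence n m = σ (suc (suc n)) m ≈ (shift (σ (suc n)) m + γ m * σ (suc n) m) + ι 2 * e n * (shift (ω n) m + γ m * ω n m) + e n * e n * σ n m

    -- Multiplying by D = (k+1)(i+1)(i+2) turns every binomial coefficient bⱼ into
    -- G qⱼ with G = C(k+i, k) (absorption identities) and every product of rising
    -- factorials into U Y rⱼ, so the recurrence becomes the polynomial identity cleared.
    module σ-RecurrenceInterior (k i : ℕ) where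
      rescale : ∀ {D b G q R U Y t} → D * b ≈ G * q → R ≈ U * Y * t → D * (b * R) ≈ G * U * Y * (q * t)
      rescale {D} {b} {G} {q} {R} {U} {Y} {t} eb eR = begin
        D * (b * R) ≈⟨ sym (*-assoc _ _ _) ⟩
        D * b * R ≈⟨ *-cong eb eR ⟩
        G * q * (U * Y * t) ≈⟨ solve 5 (λ G q U Y t → G :* q :* (U :* Y :* t) := G :* U :* Y :* (q :* t)) refl G q U Y t ⟩
        G * U * Y * (q * t) ∎

      n : ℕ
      n = suc (k ℕ.+ i)
      K I G b₁ b₂ b₃ b₄ b₅ U Y Z GUY term₁ term₂ term₃ term₄ term₅ term₆ γ[k+1] D : Carrier
      K = ι k
      I = ι i
      G = ι ((k ℕ.+ i) C k)
      b₁ = ι ((suc k ℕ.+ suc (suc i)) C (suc k))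
      b₂ = ι ((k ℕ.+ suc (suc i)) C k)
      b₃ = ι ((suc k ℕ.+ suc i) C (suc k))
      b₄ = ι ((k ℕ.+ suc i) C k)
      b₅ = ι ((suc k ℕ.+ i) C (suc k))
      U = rising (ρ + ι (suc (suc k))) i
      Y = rising (ρ + ι (suc (suc k ℕ.+ suc k))) i
      Z = rising (ρ + ι (suc (suc (suc k ℕ.+ suc k)))) i
      GUY = G * U * Y
      term₁ = σ (suc (suc n)) (suc k)
      term₂ = σ (suc n) k
      term₃ = σ (suc n) (suc k)
      term₄ = ω n k
      term₅ = ω n (suc k)
      term₆ = σ n (suc k)
      γ[k+1] = γ (suc k)
      D = (1# + K) * ((1# + I) * (1# + (1# + I)))

      D≉0 : ¬ (D ≈ 0#)
      D≉0 = *-≉0 (char0 k) (*-≉0 (char0 i) (char0 (suc i)))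
      a0 a1 c1 c1′ c0 c0′ c0b c0b′ E′ : Carrier
      a0 = ρ + (1# + K)
      a1 = ρ + (1# + (1# + K))
      c1 = ρ + ι (suc (suc k ℕ.+ suc k))
      c1′ = ρ + (1# + (1# + (K + (1# + K))))
      c0 = ρ + ι (suc (k ℕ.+ k))
      c0′ = ρ + (1# + (K + K))
      c0b = ρ + ι (suc (suc (k ℕ.+ k)))
      c0b′ = ρ + (1# + (1# + (K + K)))
      E′ = (1# + (1# + (K + I))) * (ρ + (1# + (1# + (K + I))))

      c1≈ : c1 ≈ c1′
      c1≈ = +-congˡ (+-congˡ (+-congˡ (fromℕ-+ k (suc k))))

      c0≈ : c0 ≈ c0′
      c0≈ = +-congˡ (+-congˡ (fromℕ-+ k k))

      c0b≈ : c0b ≈ c0b′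
      c0b≈ = +-congˡ (+-congˡ (+-congˡ (fromℕ-+ k k)))

      e≈E′ : e n ≈ E′
      e≈E′ = *-cong (+-congˡ (+-congˡ (fromℕ-+ k i))) (+-congˡ (+-congˡ (+-congˡ (fromℕ-+ k i))))

      γ≈c1′² : γ[k+1] ≈ c1′ * c1′
      γ≈c1′² = *-cong c1≈ c1≈
      q₁ q₂ q₃ q₄ q₅ r₁ r₂ r₃ r₄ r₅ : Carrier
      q₁ = (1# + (1# + (1# + (K + I)))) * (1# + (1# + (K + I))) * (1# + (K + I))
      q₂ = (1# + K) * (1# + (K + I)) * (1# + (1# + (K + I)))
      q₃ = (1# + (1# + I)) * (1# + (1# + (K + I))) * (1# + (K + I))
      q₄ = (1# + K) * (1# + (1# + I)) * (1# + (K + I))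
      q₅ = (1# + I) * (1# + (1# + I)) * (1# + (K + I))
      r₁ = (a1 + I) * (a1 + (1# + I)) * ((c1′ + I) * (c1′ + (1# + I)))
      r₂ = a0 * (a1 + I) * (c0′ * (c0′ + 1#))
      r₃ = (a1 + I) * (c1′ + I)
      r₄ = a0 * c0b′
      r₅ = c1′ * (c1′ + I)

      D*b₄≈G*q₄ : D * b₄ ≈ G * q₄
      D*b₄≈G*q₄ = begin
        D * b₄ ≈⟨ solve 3 (λ K I b → (con (+ 1) :+ K) :* ((con (+ 1) :+ I) :* (con (+ 1) :+ (con (+ 1) :+ I))) :* b := ((con (+ 1) :+ K) :* (con (+ 1) :+ (con (+ 1) :+ I))) :* (b :* (con (+ 1) :+ I))) refl K I b₄ ⟩
        ((1# + K) * (1# + (1# + I))) * (b₄ * (1# + I)) ≈⟨ *-congˡ (ι-C-suc-top k i) ⟩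
        ((1# + K) * (1# + (1# + I))) * ((1# + (K + I)) * G) ≈⟨ solve 3 (λ K I G → ((con (+ 1) :+ K) :* (con (+ 1) :+ (con (+ 1) :+ I))) :* ((con (+ 1) :+ (K :+ I)) :* G) := G :* ((con (+ 1) :+ K) :* (con (+ 1) :+ (con (+ 1) :+ I)) :* (con (+ 1) :+ (K :+ I)))) refl K I G ⟩
        G * q₄ ∎

      D*b₅≈G*q₅ : D * b₅ ≈ G * q₅
      D*b₅≈G*q₅ = begin
        D * b₅ ≈⟨ solve 3 (λ K I b → (con (+ 1) :+ K) :* ((con (+ 1) :+ I) :* (con (+ 1) :+ (con (+ 1) :+ I))) :* b := ((con (+ 1) :+ I) :* (con (+ 1) :+ (con (+ 1) :+ I))) :* (b :* (con (+ 1) :+ K))) refl K I b₅ ⟩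
        ((1# + I) * (1# + (1# + I))) * (b₅ * (1# + K)) ≈⟨ *-congˡ (ι-C-suc-suc k i) ⟩
        ((1# + I) * (1# + (1# + I))) * ((1# + (K + I)) * G) ≈⟨ solve 3 (λ K I G → ((con (+ 1) :+ I) :* (con (+ 1) :+ (con (+ 1) :+ I))) :* ((con (+ 1) :+ (K :+ I)) :* G) := G :* ((con (+ 1) :+ I) :* (con (+ 1) :+ (con (+ 1) :+ I)) :* (con (+ 1) :+ (K :+ I)))) refl K I G ⟩
        G * q₅ ∎

      D*b₂≈G*q₂ : D * b₂ ≈ G * q₂
      D*b₂≈G*q₂ = begin
        D * b₂ ≈⟨ solve 3 (λ K I b → (con (+ 1) :+ K) :* ((con (+ 1) :+ I) :* (con (+ 1) :+ (con (+ 1) :+ I))) :* b := ((con (+ 1) :+ K) :* (con (+ 1) :+ I)) :* (b :* (con (+ 1) :+ (con (+ 1) :+ I)))) refl K I b₂ ⟩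
        ((1# + K) * (1# + I)) * (b₂ * (1# + (1# + I))) ≈⟨ *-congˡ (ι-C-suc-top k (suc i)) ⟩
        ((1# + K) * (1# + I)) * ((1# + (K + (1# + I))) * b₄) ≈⟨ solve 3 (λ K I b → ((con (+ 1) :+ K) :* (con (+ 1) :+ I)) :* ((con (+ 1) :+ (K :+ (con (+ 1) :+ I))) :* b) := ((con (+ 1) :+ K) :* (con (+ 1) :+ (K :+ (con (+ 1) :+ I)))) :* (b :* (con (+ 1) :+ I))) refl K I b₄ ⟩
        ((1# + K) * (1# + (K + (1# + I)))) * (b₄ * (1# + I)) ≈⟨ *-congˡ (ι-C-suc-top k i) ⟩
        ((1# + K) * (1# + (K + (1# + I)))) * ((1# + (K + I)) * G) ≈⟨ solve 3 (λ K I G → ((con (+ 1) :+ K) :* (con (+ 1) :+ (K :+ (con (+ 1) :+ I)))) :* ((con (+ 1) :+ (K :+ I)) :* G) := G :* ((con (+ 1) :+ K) :* (con (+ 1) :+ (K :+ I)) :* (con (+ 1) :+ (con (+ 1) :+ (K :+ I))))) refl K I G ⟩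
        G * q₂ ∎

      D*b₃≈G*q₃ : D * b₃ ≈ G * q₃
      D*b₃≈G*q₃ = begin
        D * b₃ ≈⟨ solve 3 (λ K I b → (con (+ 1) :+ K) :* ((con (+ 1) :+ I) :* (con (+ 1) :+ (con (+ 1) :+ I))) :* b := ((con (+ 1) :+ I) :* (con (+ 1) :+ (con (+ 1) :+ I))) :* (b :* (con (+ 1) :+ K))) refl K I b₃ ⟩
        ((1# + I) * (1# + (1# + I))) * (b₃ * (1# + K)) ≈⟨ *-congˡ (ι-C-suc-suc k (suc i)) ⟩
        ((1# + I) * (1# + (1# + I))) * ((1# + (K + (1# + I))) * b₄) ≈⟨ solve 3 (λ K I b → ((con (+ 1) :+ I) :* (con (+ 1) :+ (con (+ 1) :+ I))) :* ((con (+ 1) :+ (K :+ (con (+ 1) :+ I))) :* b) := ((con (+ 1) :+ (con (+ 1) :+ I)) :* (con (+ 1) :+ (K :+ (con (+ 1) :+ I)))) :* (b :* (con (+ 1) :+ I))) refl K I b₄ ⟩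
        ((1# + (1# + I)) * (1# + (K + (1# + I)))) * (b₄ * (1# + I)) ≈⟨ *-congˡ (ι-C-suc-top k i) ⟩
        ((1# + (1# + I)) * (1# + (K + (1# + I)))) * ((1# + (K + I)) * G) ≈⟨ solve 3 (λ K I G → ((con (+ 1) :+ (con (+ 1) :+ I)) :* (con (+ 1) :+ (K :+ (con (+ 1) :+ I)))) :* ((con (+ 1) :+ (K :+ I)) :* G) := G :* ((con (+ 1) :+ (con (+ 1) :+ I)) :* (con (+ 1) :+ (con (+ 1) :+ (K :+ I))) :* (con (+ 1) :+ (K :+ I)))) refl K I G ⟩
        G * q₃ ∎

      D*b₁≈G*q₁ : D * b₁ ≈ G * q₁
      D*b₁≈G*q₁ = begin
        D * b₁ ≈⟨ solve 3 (λ K I b → (con (+ 1) :+ K) :* ((con (+ 1) :+ I) :* (con (+ 1) :+ (con (+ 1) :+ I))) :* b := ((con (+ 1) :+ I) :* (con (+ 1) :+ (con (+ 1) :+ I))) :* (b :* (con (+ 1) :+ K))) refl K I b₁ ⟩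
        ((1# + I) * (1# + (1# + I))) * (b₁ * (1# + K)) ≈⟨ *-congˡ (ι-C-suc-suc k (suc (suc i))) ⟩
        ((1# + I) * (1# + (1# + I))) * ((1# + (K + (1# + (1# + I)))) * b₂) ≈⟨ solve 3 (λ K I b → ((con (+ 1) :+ I) :* (con (+ 1) :+ (con (+ 1) :+ I))) :* ((con (+ 1) :+ (K :+ (con (+ 1) :+ (con (+ 1) :+ I)))) :* b) := ((con (+ 1) :+ I) :* (con (+ 1) :+ (K :+ (con (+ 1) :+ (con (+ 1) :+ I))))) :* (b :* (con (+ 1) :+ (con (+ 1) :+ I)))) refl K I b₂ ⟩
        ((1# + I) * (1# + (K + (1# + (1# + I))))) * (b₂ * (1# + (1# + I))) ≈⟨ *-congˡ (ι-C-suc-top k (suc i)) ⟩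
        ((1# + I) * (1# + (K + (1# + (1# + I))))) * ((1# + (K + (1# + I))) * b₄) ≈⟨ solve 3 (λ K I b → ((con (+ 1) :+ I) :* (con (+ 1) :+ (K :+ (con (+ 1) :+ (con (+ 1) :+ I))))) :* ((con (+ 1) :+ (K :+ (con (+ 1) :+ I))) :* b) := ((con (+ 1) :+ (K :+ (con (+ 1) :+ (con (+ 1) :+ I)))) :* (con (+ 1) :+ (K :+ (con (+ 1) :+ I)))) :* (b :* (con (+ 1) :+ I))) refl K I b₄ ⟩
        ((1# + (K + (1# + (1# + I)))) * (1# + (K + (1# + I)))) * (b₄ * (1# + I)) ≈⟨ *-congˡ (ι-C-suc-top k i) ⟩
        ((1# + (K + (1# + (1# + I)))) * (1# + (K + (1# + I)))) * ((1# + (K + I)) * G) ≈⟨ solve 3 (λ K I G → ((con (+ 1) :+ (K :+ (con (+ 1) :+ (con (+ 1) :+ I)))) :* (con (+ 1) :+ (K :+ (con (+ 1) :+ I)))) :* ((con (+ 1) :+ (K :+ I)) :* G) := G :* ((con (+ 1) :+ (con (+ 1) :+ (con (+ 1) :+ (K :+ I)))) :* (con (+ 1) :+ (con (+ 1) :+ (K :+ I))) :* (con (+ 1) :+ (K :+ I)))) refl K I G ⟩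
        G * q₁ ∎

      cleared : GUY * (q₁ * r₁) ≈ (GUY * (q₂ * r₂) + c1′ * c1′ * (GUY * (q₃ * r₃))) + ι 2 * E′ * (GUY * (q₄ * r₄) + GUY * (q₅ * r₅)) + E′ * E′ * (GUY * (q₅ * 1#))
      cleared = solve 6 (λ G U Y p K I →
          let o = con (+ 1)
              a0 = p :+ (o :+ K)
              a1 = p :+ (o :+ (o :+ K))
              c1 = p :+ (o :+ (o :+ (K :+ (o :+ K))))
              c0 = p :+ (o :+ (K :+ K))
              c0b = p :+ (o :+ (o :+ (K :+ K)))
              E = (o :+ (o :+ (K :+ I))) :* (p :+ (o :+ (o :+ (K :+ I))))
              q₁ = (o :+ (o :+ (o :+ (K :+ I)))) :* (o :+ (o :+ (K :+ I))) :* (o :+ (K :+ I))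
              q₂ = (o :+ K) :* (o :+ (K :+ I)) :* (o :+ (o :+ (K :+ I)))
              q₃ = (o :+ (o :+ I)) :* (o :+ (o :+ (K :+ I))) :* (o :+ (K :+ I))
              q₄ = (o :+ K) :* (o :+ (o :+ I)) :* (o :+ (K :+ I))
              q₅ = (o :+ I) :* (o :+ (o :+ I)) :* (o :+ (K :+ I))
              r₁ = (a1 :+ I) :* (a1 :+ (o :+ I)) :* ((c1 :+ I) :* (c1 :+ (o :+ I)))
              r₂ = a0 :* (a1 :+ I) :* (c0 :* (c0 :+ o))
              r₃ = (a1 :+ I) :* (c1 :+ I)
              r₄ = a0 :* c0b
              r₅ = c1 :* (c1 :+ I)
              g = G :* U :* Y
          in g :* (q₁ :* r₁) := (g :* (q₂ :* r₂) :+ c1 :* c1 :* (g :* (q₃ :* r₃))) :+ con (+ 2) :* E :* (g :* (q₄ :* r₄) :+ g :* (q₅ :* r₅)) :+ E :* E :* (g :* (q₅ :* o)))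
        refl G U Y ρ K I

      ι[k+[1+k]] : ι (k ℕ.+ suc k) ≈ 1# + ι (k ℕ.+ k)
      ι[k+[1+k]] = ι-cong (ℕ.+-suc k k)

      P₁≈UY*r₁ : P (suc k) (suc (suc i)) ≈ U * Y * r₁
      P₁≈UY*r₁ = trans (*-congˡ (*-cong (*-congˡ (+-congʳ c1≈)) (+-congʳ c1≈)))
                 (solve 5 (λ U Y a c I → (U :* (a :+ I) :* (a :+ (con (+ 1) :+ I))) :* (Y :* (c :+ I) :* (c :+ (con (+ 1) :+ I))) := U :* Y :* ((a :+ I) :* (a :+ (con (+ 1) :+ I)) :* ((c :+ I) :* (c :+ (con (+ 1) :+ I))))) refl U Y a1 c1′ I)

      P₂≈UY*r₂ : P k (suc (suc i)) ≈ U * Y * r₂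
      P₂≈UY*r₂ = begin
        rising a0 (suc (suc i)) * rising c0 (suc (suc i))
          ≈⟨ *-cong (trans (rising-suc a0 (suc i)) (*-congˡ (rising-cong (suc i) (solve 2 (λ p K → (p :+ (con (+ 1) :+ K)) :+ con (+ 1) := p :+ (con (+ 1) :+ (con (+ 1) :+ K))) refl ρ K))))
                    (trans (rising-suc c0 (suc i)) (*-congˡ (trans (rising-suc (c0 + 1#) i) (*-congˡ (rising-cong i c0+2≈c1))))) ⟩
        (a0 * (U * (a1 + I))) * (c0 * ((c0 + 1#) * Y))
          ≈⟨ *-congˡ (*-cong c0≈ (*-congʳ (+-congʳ c0≈))) ⟩
        (a0 * (U * (a1 + I))) * (c0′ * ((c0′ + 1#) * Y))
          ≈⟨ solve 6 (λ U Y a b c I → (a :* (U :* (b :+ I))) :* (c :* ((c :+ con (+ 1)) :* Y)) := U :* Y :* (a :* (b :+ I) :* (c :* (c :+ con (+ 1))))) refl U Y a0 a1 c0′ I ⟩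
        U * Y * r₂ ∎
        where
        c0+2≈c1 : c0 + 1# + 1# ≈ ρ + ι (suc (suc k ℕ.+ suc k))
        c0+2≈c1 = trans (solve 2 (λ p L → p :+ (con (+ 1) :+ L) :+ con (+ 1) :+ con (+ 1) := p :+ (con (+ 1) :+ (con (+ 1) :+ (con (+ 1) :+ L)))) refl ρ (ι (k ℕ.+ k)))
                    (+-congˡ (+-congˡ (+-congˡ (sym ι[k+[1+k]]))))

      P₃≈UY*r₃ : P (suc k) (suc i) ≈ U * Y * r₃
      P₃≈UY*r₃ = trans (*-congˡ (*-congˡ (+-congʳ c1≈)))
                 (solve 5 (λ U Y a c I → (U :* (a :+ I)) :* (Y :* (c :+ I)) := U :* Y :* ((a :+ I) :* (c :+ I))) refl U Y a1 c1′ I)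

      Q₄≈UY*r₄ : Q k (suc i) ≈ U * Y * r₄
      Q₄≈UY*r₄ = begin
        rising a0 (suc i) * rising c0b (suc i)
          ≈⟨ *-cong (trans (rising-suc a0 i) (*-congˡ (rising-cong i (solve 2 (λ p K → (p :+ (con (+ 1) :+ K)) :+ con (+ 1) := p :+ (con (+ 1) :+ (con (+ 1) :+ K))) refl ρ K))))
                    (trans (rising-suc c0b i) (*-congˡ (rising-cong i c0b+1≈c1))) ⟩
        (a0 * U) * (c0b * Y) ≈⟨ *-congˡ (*-congʳ c0b≈) ⟩
        (a0 * U) * (c0b′ * Y) ≈⟨ solve 4 (λ U Y a c → (a :* U) :* (c :* Y) := U :* Y :* (a :* c)) refl U Y a0 c0b′ ⟩
        U * Y * r₄ ∎
        where
        c0b+1≈c1 : c0b + 1# ≈ ρ + ι (suc (suc k ℕ.+ suc k))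
        c0b+1≈c1 = trans (solve 2 (λ p L → p :+ (con (+ 1) :+ (con (+ 1) :+ L)) :+ con (+ 1) := p :+ (con (+ 1) :+ (con (+ 1) :+ (con (+ 1) :+ L)))) refl ρ (ι (k ℕ.+ k)))
                    (+-congˡ (+-congˡ (+-congˡ (sym ι[k+[1+k]]))))

      c1*Z≈ : c1 * Z ≈ Y * (c1 + I)
      c1*Z≈ = sym (trans (rising-suc c1 i) (*-congˡ (rising-cong i (solve 2 (λ p L → p :+ L :+ con (+ 1) := p :+ (con (+ 1) :+ L)) refl ρ (ι (suc (suc k ℕ.+ suc k)))))))

      γQ₅≈UY*r₅ : γ[k+1] * Q (suc k) i ≈ U * Y * r₅
      γQ₅≈UY*r₅ = begin
        (c1 * c1) * (U * Z) ≈⟨ solve 4 (λ c U Z x → (c :* c) :* (U :* Z) := c :* U :* (c :* Z)) refl c1 U Z 0# ⟩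
        c1 * U * (c1 * Z) ≈⟨ *-congˡ c1*Z≈ ⟩
        c1 * U * (Y * (c1 + I)) ≈⟨ *-cong (*-congʳ c1≈) (*-congˡ (+-congʳ c1≈)) ⟩
        c1′ * U * (Y * (c1′ + I)) ≈⟨ solve 4 (λ c U Y I → c :* U :* (Y :* (c :+ I)) := U :* Y :* (c :* (c :+ I))) refl c1′ U Y I ⟩
        U * Y * r₅ ∎

      P₆≈UY*1 : P (suc k) i ≈ U * Y * 1#
      P₆≈UY*1 = sym (*-identityʳ _)

      2+k+i≡k+[2+i] : suc (suc (k ℕ.+ i)) ≡ k ℕ.+ suc (suc i)
      2+k+i≡k+[2+i] = ≡.sym (≡.trans (ℕ.+-suc k (suc i)) (≡.cong suc (ℕ.+-suc k i)))

      D*term₁≈ : D * term₁ ≈ GUY * (q₁ * r₁)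
      D*term₁≈ = trans (*-congˡ (σ-unfold _ (suc k) (suc (suc i)) (≡.cong suc 2+k+i≡k+[2+i]))) (rescale D*b₁≈G*q₁ P₁≈UY*r₁)

      D*term₂≈ : D * term₂ ≈ GUY * (q₂ * r₂)
      D*term₂≈ = trans (*-congˡ (σ-unfold _ k (suc (suc i)) 2+k+i≡k+[2+i])) (rescale D*b₂≈G*q₂ P₂≈UY*r₂)

      D*term₃≈ : D * term₃ ≈ GUY * (q₃ * r₃)
      D*term₃≈ = trans (*-congˡ (σ-unfold _ (suc k) (suc i) (≡.cong suc (≡.sym (ℕ.+-suc k i))))) (rescale D*b₃≈G*q₃ P₃≈UY*r₃)

      D*term₄≈ : D * term₄ ≈ GUY * (q₄ * r₄)
      D*term₄≈ = trans (*-congˡ (ω-unfold _ k (suc i) (≡.sym (ℕ.+-suc k i)))) (rescale D*b₄≈G*q₄ Q₄≈UY*r₄)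

      D*γ*term₅≈ : D * (γ[k+1] * term₅) ≈ GUY * (q₅ * r₅)
      D*γ*term₅≈ = trans (*-congˡ (*-congˡ (ω-unfold _ (suc k) i ≡.refl))) (trans (*-congˡ (solve 3 (λ c b q → c :* (b :* q) := b :* (c :* q)) refl γ[k+1] b₅ (Q (suc k) i))) (rescale D*b₅≈G*q₅ γQ₅≈UY*r₅))

      D*term₆≈ : D * term₆ ≈ GUY * (q₅ * 1#)
      D*term₆≈ = trans (*-congˡ (σ-unfold _ (suc k) i ≡.refl)) (rescale D*b₅≈G*q₅ P₆≈UY*1)


      identity : σ-Recurrence (suc (k ℕ.+ i)) (suc k)
      identity = *-cancelˡ D≉0 (begin
        D * term₁ ≈⟨ D*term₁≈ ⟩
        GUY * (q₁ * r₁) ≈⟨ cleared ⟩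
        (GUY * (q₂ * r₂) + c1′ * c1′ * (GUY * (q₃ * r₃))) + ι 2 * E′ * (GUY * (q₄ * r₄) + GUY * (q₅ * r₅)) + E′ * E′ * (GUY * (q₅ * 1#))
          ≈⟨ sym (+-cong (+-cong (+-cong D*term₂≈ (*-cong γ≈c1′² D*term₃≈)) (*-cong (*-congˡ e≈E′) (+-cong D*term₄≈ D*γ*term₅≈))) (*-cong (*-cong e≈E′ e≈E′) D*term₆≈)) ⟩
        (D * term₂ + γ[k+1] * (D * term₃)) + ι 2 * e n * (D * term₄ + D * (γ[k+1] * term₅)) + e n * e n * (D * term₆)
          ≈⟨ solve 9 (λ D a2 a3 a4 a5 a6 c t e → (D :* a2 :+ c :* (D :* a3)) :+ t :* e :* (D :* a4 :+ D :* (c :* a5)) :+ e :* e :* (D :* a6)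
                         := D :* ((a2 :+ c :* a3) :+ t :* e :* (a4 :+ c :* a5) :+ e :* e :* a6)) refl D term₂ term₃ term₄ term₅ term₆ γ[k+1] (ι 2) (e n) ⟩
        D * ((term₂ + γ[k+1] * term₃) + ι 2 * e n * (term₄ + γ[k+1] * term₅) + e n * e n * term₆) ∎)

    σ-diag : ∀ n → σ n n ≈ 1#
    σ-diag n rewrite nCn≡1 n | ℕ.n∸n≡0 n = solve 0 ((con (+ 1) :+ con (+ 0)) :* (con (+ 1) :* con (+ 1)) := con (+ 1)) refl

    ω-diag : ∀ n → ω n n ≈ 1#
    ω-diag n rewrite nCn≡1 n | ℕ.n∸n≡0 n = solve 0 ((con (+ 1) :+ con (+ 0)) :* (con (+ 1) :* con (+ 1)) := con (+ 1)) refl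

    σ-recurrence-top : ∀ n → σ-Recurrence n (suc (suc n))
    σ-recurrence-top n = begin
      σ (suc (suc n)) (suc (suc n))
        ≈⟨ σ-diag (suc (suc n)) ⟩
      1#
        ≈⟨ solve 3 (λ g t f → con (+ 1) := (con (+ 1) :+ g :* con (+ 0)) :+ t :* (con (+ 0) :+ g :* con (+ 0)) :+ f :* con (+ 0)) refl (γ (suc (suc n))) (ι 2 * e n) (e n * e n) ⟩
      (1# + γ (suc (suc n)) * 0#) + ι 2 * e n * (0# + γ (suc (suc n)) * 0#) + e n * e n * 0#
        ≈⟨ sym (+-cong (+-cong (+-cong (σ-diag (suc n)) (*-congˡ (σ-vanishes (suc n) (suc (suc n)) (ℕ.n<1+n (suc n)))))
                               (*-congˡ (+-cong (ω-vanishes n (suc n) n<1+n) (*-congˡ (ω-vanishes n (suc (suc n)) (ℕ.m<n⇒m<1+n n<1+n))))))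
                       (*-congˡ (σ-vanishes n (suc (suc n)) (ℕ.m<n⇒m<1+n n<1+n)))) ⟩
      (shift (σ (suc n)) (suc (suc n)) + γ (suc (suc n)) * σ (suc n) (suc (suc n)))
        + ι 2 * e n * (shift (ω n) (suc (suc n)) + γ (suc (suc n)) * ω n (suc (suc n))) + e n * e n * σ n (suc (suc n))
        ∎
      where
      n<1+n : n < suc n
      n<1+n = ℕ.n<1+n n

    σ-recurrence-subtop : ∀ n → σ-Recurrence n (suc n)
    σ-recurrence-subtop n = begin
      σ (suc (suc n)) (suc n)
        ≈⟨ trans (σ-unfold _ (suc n) 1 (≡.cong suc (≡.sym (ℕ.+-comm n 1)))) (*-cong (ι-cong ([n+1]Cn≡1+n (suc n))) (*-congˡ (*-congˡ (+-congʳ ρ+2n+3≈)))) ⟩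
      (1# + (1# + N)) * ((1# * (ρ + (1# + (1# + N)) + 0#)) * (1# * (ρ+2n+3 + 0#)))
        ≈⟨ solve 3 (λ p N E → let o = con (+ 1); z = con (+ 0); c = p :+ (o :+ (o :+ (N :+ (o :+ N)))) in
                (o :+ (o :+ N)) :* ((o :* (p :+ (o :+ (o :+ N)) :+ z)) :* (o :* (c :+ z)))
             := ((o :+ N) :* ((o :* (p :+ (o :+ N) :+ z)) :* (o :* (p :+ (o :+ (N :+ N)) :+ z))) :+ (c :* c) :* o)
                :+ con (+ 2) :* ((o :+ N) :* (p :+ (o :+ N))) :* (o :+ (c :* c) :* z) :+ E :* E :* z) refl ρ N (e n) ⟩
      ((1# + N) * ((1# * (ρ + (1# + N) + 0#)) * (1# * (ρ+2n+1 + 0#))) + (ρ+2n+3 * ρ+2n+3) * 1#)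
        + ι 2 * e n * (1# + (ρ+2n+3 * ρ+2n+3) * 0#) + e n * e n * 0#
        ≈⟨ sym (+-cong (+-cong (+-cong (trans (σ-unfold _ n 1 (≡.sym (ℕ.+-comm n 1))) (*-cong (ι-cong ([n+1]Cn≡1+n n)) (*-congˡ (*-congˡ (+-congʳ ρ+2n+1≈)))))
                                       (*-cong (*-cong ρ+2n+3≈ ρ+2n+3≈) (σ-diag (suc n))))
                               (*-congˡ (+-cong (ω-diag n) (*-cong (*-cong ρ+2n+3≈ ρ+2n+3≈) (ω-vanishes n (suc n) (ℕ.n<1+n n))))))
                       (*-congˡ (σ-vanishes n (suc n) (ℕ.n<1+n n)))) ⟩
      (shift (σ (suc n)) (suc n) + γ (suc n) * σ (suc n) (suc n))
        + ι 2 * e n * (shift (ω n) (suc n) + γ (suc n) * ω n (suc n)) + e n * e n * σ n (suc n)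
        ∎
      where
      N ρ+2n+3 ρ+2n+1 : Carrier
      N = ι n
      ρ+2n+3 = ρ + (1# + (1# + (N + (1# + N))))
      ρ+2n+1 = ρ + (1# + (N + N))
      ρ+2n+3≈ : ρ + ι (suc (suc n ℕ.+ suc n)) ≈ ρ+2n+3
      ρ+2n+3≈ = +-congˡ (+-congˡ (+-congˡ (fromℕ-+ n (suc n))))
      ρ+2n+1≈ : ρ + ι (suc (n ℕ.+ n)) ≈ ρ+2n+1
      ρ+2n+1≈ = +-congˡ (+-congˡ (fromℕ-+ n n))

    σ-recurrence-zero : ∀ n → σ-Recurrence n 0
    σ-recurrence-zero n = begin
      σ (suc (suc n)) 0
          ≈⟨ solve 3 (λ p N U → let o = con (+ 1); z = con (+ 0); c0 = p :+ (o :+ z); e = (o :+ N) :* (p :+ (o :+ N)) in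
                 (o :+ z) :* ((U :* (c0 :+ N) :* (c0 :+ (o :+ N))) :* (U :* (c0 :+ N) :* (c0 :+ (o :+ N))))
              := (z :+ (c0 :* c0) :* ((o :+ z) :* ((U :* (c0 :+ N)) :* (U :* (c0 :+ N))))) :+ con (+ 2) :* e :* (z :+ c0 :* (o :+ z) :* U :* (U :* (c0 :+ N))) :+ e :* e :* ((o :+ z) :* (U :* U))) refl ρ N U ⟩
        (0# + (c0 * c0) * σ (suc n) 0) + ι 2 * e n * (0# + c0 * ι 1 * U * (U * (c0 + N))) + e n * e n * σ n 0
          ≈⟨ +-congʳ (+-congˡ (*-congˡ (+-congˡ (sym γ0*ω≈)))) ⟩
        (0# + γ 0 * σ (suc n) 0) + ι 2 * e n * (0# + γ 0 * ω n 0) + e n * e n * σ n 0 ∎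
      where
      N c0 U Z : Carrier
      N = ι n
      c0 = ρ + ι 1
      U = rising c0 n
      Z = rising (ρ + ι 2) n
      c0*Z≈ : c0 * Z ≈ U * (c0 + N)
      c0*Z≈ = sym (trans (rising-suc c0 n) (*-congˡ (rising-cong n (solve 1 (λ p → p :+ (con (+ 1) :+ con (+ 0)) :+ con (+ 1) := p :+ (con (+ 1) :+ (con (+ 1) :+ con (+ 0)))) refl ρ))))
      γ0*ω≈ : γ 0 * ω n 0 ≈ c0 * ι 1 * U * (U * (c0 + N))
      γ0*ω≈ = begin
        (c0 * c0) * (ι 1 * (U * Z)) ≈⟨ solve 4 (λ c i U Z → (c :* c) :* (i :* (U :* Z)) := c :* i :* U :* (c :* Z)) refl c0 (ι 1) U Z ⟩
        c0 * ι 1 * U * (c0 * Z) ≈⟨ *-congˡ c0*Z≈ ⟩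
        c0 * ι 1 * U * (U * (c0 + N)) ∎

    σ-recurrence : ∀ n m → m ≤ suc (suc n) → σ-Recurrence n m
    σ-recurrence n zero _ = σ-recurrence-zero n
    σ-recurrence n (suc k) (s≤s k≤) with ℕ.m≤n⇒m<n∨m≡n k≤
    ... | inj₂ ≡.refl = σ-recurrence-top n
    ... | inj₁ (s≤s k≤n) with ℕ.m≤n⇒m<n∨m≡n k≤n
    ...   | inj₂ ≡.refl = σ-recurrence-subtop n
    ...   | inj₁ sk≤n with ℕ.m≤n⇒∃[o]m+o≡n sk≤n
    ...     | i , eq = ≡.subst (λ n → σ-Recurrence n (suc k)) eq (σ-RecurrenceInterior.identity k i)


    -- S n is (n!)² times the right-hand side of the theorem, and A * W (suc n) = d̂ (suc n) * d̂ n.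
    S W : ℕ → Carrier
    S n = series n (σ n)
    W zero = 0#
    W (suc n) = series n (ω n)

    W-suc-suc : ∀ n → W (suc (suc n)) ≈ S (suc n) + e n * W (suc n)
    W-suc-suc n = sym (begin
      S (suc n) + e n * series n (ω n)
        ≈⟨ +-congˡ (*-congˡ (series-suc-≈0 n (ω n) (ω-vanishes n (suc n) (ℕ.n<1+n n)))) ⟨
      S (suc n) + e n * series (suc n) (ω n)
        ≈⟨ series-+-* (suc n) (e n) (σ (suc n)) (ω n) ⟩
      series (suc n) (λ m → σ (suc n) m + e n * ω n m)
        ≈⟨ series-cong (suc n) (λ m m≤ → sym (ω-recurrence n m m≤)) ⟩
      W (suc (suc n))
        ∎)

    S-one : S 1 ≈ A * A * S 0
    S-one = sym (begin
      A * A * S 0                                  ≈⟨ A*A*series 0 (σ 0) (σ-vanishes 0 1 (s≤s z≤n)) ⟩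
      series 1 (λ m → shift (σ 0) m + γ m * σ 0 m) ≈⟨ series-cong 1 (λ m m≤1 → sym (σ-recurrence-one m m≤1)) ⟩
      S 1                                          ∎)

    S-suc-suc : ∀ n → S (suc (suc n)) ≈ A * A * S (suc n) + ι 2 * e n * (A * A * W (suc n)) + e n * e n * S n
    S-suc-suc n = sym (begin
      A * A * S (suc n) + ι 2 * e n * (A * A * W (suc n)) + e n * e n * S n
        ≈⟨ +-cong (+-cong (A*A*series (suc n) (σ (suc n)) (σ-vanishes (suc n) (suc (suc n)) (ℕ.n<1+n (suc n))))
                          (*-congˡ A*A*W))
                  (*-congˡ S≈) ⟩
      series (suc (suc n)) f + ι 2 * e n * series (suc (suc n)) g + e n * e n * series (suc (suc n)) (σ n)
        ≈⟨ +-congʳ (series-+-* (suc (suc n)) (ι 2 * e n) f g) ⟩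
      series (suc (suc n)) (λ m → f m + ι 2 * e n * g m) + e n * e n * series (suc (suc n)) (σ n)
        ≈⟨ series-+-* (suc (suc n)) (e n * e n) _ (σ n) ⟩
      series (suc (suc n)) (λ m → f m + ι 2 * e n * g m + e n * e n * σ n m)
        ≈⟨ series-cong (suc (suc n)) (λ m m≤ → sym (σ-recurrence n m m≤)) ⟩
      S (suc (suc n))
        ∎)
      where
      f g : ℕ → Carrier
      f m = shift (σ (suc n)) m + γ m * σ (suc n) m
      g m = shift (ω n) m + γ m * ω n m
      n<1+n : n < suc n
      n<1+n = ℕ.n<1+n n
      A*A*W : A * A * W (suc n) ≈ series (suc (suc n)) g
      A*A*W = trans (A*A*series n (ω n) (ω-vanishes n (suc n) n<1+n))
        (sym (series-suc-≈0 (suc n) g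
          (trans (+-cong (ω-vanishes n (suc n) n<1+n) (trans (*-congˡ (ω-vanishes n (suc (suc n)) (ℕ.m<n⇒m<1+n n<1+n))) (zeroʳ _)))
                 (+-identityʳ 0#))))
      S≈ : S n ≈ series (suc (suc n)) (σ n)
      S≈ = sym (trans (series-suc-≈0 (suc n) (σ n) (σ-vanishes n (suc (suc n)) (ℕ.m<n⇒m<1+n n<1+n)))
                      (series-suc-≈0 n (σ n) (σ-vanishes n (suc n) n<1+n)))

    Invariant : ℕ → Set ℓ
    Invariant n = (d̂ n * d̂ n ≈ S n) × (d̂ (suc n) * d̂ (suc n) ≈ S (suc n)) × (d̂ (suc n) * d̂ n ≈ A * W (suc n))

    invariant-zero : Invariant 0
    invariant-zero =
        trans (*-cong d̂-zero d̂-zero) (trans (*-identityˡ 1#) (sym S-zero))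
      , trans (*-cong d̂-one d̂-one) (sym (trans S-one (trans (*-congˡ S-zero) (*-identityʳ _))))
      , trans (*-cong d̂-one d̂-zero) (trans (*-identityʳ A) (sym (trans (*-congˡ W-one) (*-identityʳ A))))
      where
      S-zero : S 0 ≈ 1#
      S-zero = solve 0 (con (+ 1) :* (con (+ 1) :* con (+ 1)) :* ((con (+ 1) :+ con (+ 0)) :* (con (+ 1) :* con (+ 1))) := con (+ 1)) refl
      W-one : W 1 ≈ 1#
      W-one = S-zero

    invariant-suc : ∀ n → Invariant n → Invariant (suc n)
    invariant-suc n (d̂²≈S , d̂′²≈S′ , d̂′d̂≈AW′) = d̂′²≈S′ , square , product
      where
      d̂″≈ : d̂ (suc (suc n)) ≈ A * d̂ (suc n) + e n * d̂ n
      d̂″≈ = d̂-suc-suc n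
      square : d̂ (suc (suc n)) * d̂ (suc (suc n)) ≈ S (suc (suc n))
      square = begin
        d̂ (suc (suc n)) * d̂ (suc (suc n))
          ≈⟨ *-cong d̂″≈ d̂″≈ ⟩
        (A * d̂ (suc n) + e n * d̂ n) * (A * d̂ (suc n) + e n * d̂ n)
          ≈⟨ solve 4 (λ A u E v → (A :* u :+ E :* v) :* (A :* u :+ E :* v) := A :* A :* (u :* u) :+ con (+ 2) :* E :* (A :* (u :* v)) :+ E :* E :* (v :* v)) refl A (d̂ (suc n)) (e n) (d̂ n) ⟩
        A * A * (d̂ (suc n) * d̂ (suc n)) + ι 2 * e n * (A * (d̂ (suc n) * d̂ n)) + e n * e n * (d̂ n * d̂ n)
          ≈⟨ +-cong (+-cong (*-congˡ d̂′²≈S′) (*-congˡ (trans (*-congˡ d̂′d̂≈AW′) (sym (*-assoc _ _ _))))) (*-congˡ d̂²≈S) ⟩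
        A * A * S (suc n) + ι 2 * e n * (A * A * W (suc n)) + e n * e n * S n
          ≈⟨ S-suc-suc n ⟨
        S (suc (suc n))
          ∎
      product : d̂ (suc (suc n)) * d̂ (suc n) ≈ A * W (suc (suc n))
      product = begin
        d̂ (suc (suc n)) * d̂ (suc n)
          ≈⟨ *-congʳ d̂″≈ ⟩
        (A * d̂ (suc n) + e n * d̂ n) * d̂ (suc n)
          ≈⟨ solve 4 (λ A u E v → (A :* u :+ E :* v) :* u := A :* (u :* u) :+ E :* (u :* v)) refl A (d̂ (suc n)) (e n) (d̂ n) ⟩
        A * (d̂ (suc n) * d̂ (suc n)) + e n * (d̂ (suc n) * d̂ n)
          ≈⟨ +-cong (*-congˡ d̂′²≈S′) (*-congˡ d̂′d̂≈AW′) ⟩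
        A * S (suc n) + e n * (A * W (suc n))
          ≈⟨ solve 4 (λ A s E w → A :* s :+ E :* (A :* w) := A :* (s :+ E :* w)) refl A (S (suc n)) (e n) (W (suc n)) ⟩
        A * (S (suc n) + e n * W (suc n))
          ≈⟨ *-congˡ (W-suc-suc n) ⟨
        A * W (suc (suc n))
          ∎

    invariant : ∀ n → Invariant n
    invariant zero = invariant-zero
    invariant (suc n) = invariant-suc n (invariant n)

    d̂*d̂≈S : ∀ n → d̂ n * d̂ n ≈ S n
    d̂*d̂≈S n = proj₁ (invariant n)

    summand : ℕ → ℕ → Carrier
    summand n m = ((binom (x - r) m * binom (x + r + ι m) m * binom (ι n + ρ + ι m) (n ∸ m)) ÷ binom (ι m + ρ) m) * pow (ι 4) m

    module _ (ρ≉-suc : ∀ k → ¬ ρ ≈ - ι (suc k)) where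

      ρ+suc≉0 : ∀ k → ¬ ρ + ι (suc k) ≈ 0#
      ρ+suc≉0 k ρ+k+1≈0 = ρ≉-suc k (begin
        ρ                                 ≈⟨ solve 2 (λ p k → p := (p :+ k) :- k) refl ρ (ι (suc k)) ⟩
        (ρ + ι (suc k)) - ι (suc k)       ≈⟨ +-congʳ ρ+k+1≈0 ⟩
        0# - ι (suc k)                    ≈⟨ +-identityˡ _ ⟩
        - ι (suc k)                       ∎)

      falling-ι+ρ≉0 : ∀ m k → k ≤ m → ¬ falling (ι m + ρ) k ≈ 0#
      falling-ι+ρ≉0 m zero _ 1≈0 = 0≉1 (sym 1≈0)
      falling-ι+ρ≉0 m (suc k) k<m = *-≉0 (falling-ι+ρ≉0 m k (ℕ.<⇒≤ k<m)) factor≉0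
        where
        t : ℕ
        t = m ∸ suc k
        m≈k+[t+1] : ι m ≈ ι k + ι (suc t)
        m≈k+[t+1] = trans (ι-split m k (ℕ.<⇒≤ k<m)) (+-congˡ (ι-cong (ℕ.+-∸-assoc 1 k<m)))
        factor≉0 : ¬ ι m + ρ - ι k ≈ 0#
        factor≉0 factor≈0 = ρ+suc≉0 t (begin
          ρ + ι (suc t)                 ≈⟨ solve 3 (λ p k t → p :+ t := (k :+ t) :+ p :- k) refl ρ (ι k) (ι (suc t)) ⟩
          (ι k + ι (suc t)) + ρ - ι k   ≈⟨ +-congʳ (+-congʳ (sym m≈k+[t+1])) ⟩
          ι m + ρ - ι k                 ≈⟨ factor≈0 ⟩
          0#                            ∎)

      falling-ratio : ∀ m j →
        falling (ι (m ℕ.+ j) + ρ) (m ℕ.+ j) * falling (ι m + ρ) m ⁻¹ ≈ rising (ρ + ι (suc m)) j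
      falling-ratio m j = begin
        falling (ι (m ℕ.+ j) + ρ) (m ℕ.+ j) * falling (ι m + ρ) m ⁻¹
          ≈⟨ *-congʳ (reflexive (≡.cong (falling (ι (m ℕ.+ j) + ρ)) (ℕ.+-comm m j))) ⟩
        falling (ι (m ℕ.+ j) + ρ) (j ℕ.+ m) * falling (ι m + ρ) m ⁻¹
          ≈⟨ *-congʳ (falling-+ (ι (m ℕ.+ j) + ρ) j m) ⟩
        falling (ι (m ℕ.+ j) + ρ) j * falling (ι (m ℕ.+ j) + ρ - ι j) m * falling (ι m + ρ) m ⁻¹
          ≈⟨ *-congʳ (*-congˡ (falling-cong m (trans (+-congʳ (+-congʳ (fromℕ-+ m j))) (solve 3 (λ p a b → a :+ b :+ p :- b := a :+ p) refl ρ (ι m) (ι j))))) ⟩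
        falling (ι (m ℕ.+ j) + ρ) j * falling (ι m + ρ) m * falling (ι m + ρ) m ⁻¹
          ≈⟨ trans (*-assoc _ _ _) (*-congˡ (inverse _ (falling-ι+ρ≉0 m m ℕ.≤-refl))) ⟩
        falling (ι (m ℕ.+ j) + ρ) j * 1#
          ≈⟨ *-identityʳ _ ⟩
        falling (ι (m ℕ.+ j) + ρ) j
          ≈⟨ falling-cong j (trans (+-congʳ (fromℕ-+ m j)) (solve 3 (λ a b p → a :+ b :+ p := p :+ a :+ b) refl (ι m) (ι j) ρ)) ⟩
        falling (ρ + ι m + ι j) j
          ≈⟨ falling≈rising (ρ + ι m) j ⟩
        rising (ρ + ι m + 1#) j
          ≈⟨ rising-cong j (solve 2 (λ p a → p :+ a :+ con (+ 1) := p :+ (con (+ 1) :+ a)) refl ρ (ι m)) ⟩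
        rising (ρ + ι (suc m)) j
          ∎

      fact²*binom*summand : ∀ m j →
        fact (m ℕ.+ j) * fact (m ℕ.+ j) * binom (ι (m ℕ.+ j) + ρ) (m ℕ.+ j) * summand (m ℕ.+ j) m
          ≈ pow (ι 4) m * Φ m * σ (m ℕ.+ j) m
      fact²*binom*summand m j = begin
        n! * n! * (Fn * n!⁻¹) * ((((fa * m!⁻¹) * (fb * m!⁻¹) * binom (ι n + ρ + ι m) (n ∸ m)) * (Fm * m!⁻¹) ⁻¹) * p4)
          ≈⟨ *-congˡ (*-congʳ (*-cong (*-congˡ (reflexive (≡.cong (binom (ι n + ρ + ι m)) (ℕ.m+n∸m≡n m j)))) [Fm*m!⁻¹]⁻¹≈)) ⟩
        n! * n! * (Fn * n!⁻¹) * ((((fa * m!⁻¹) * (fb * m!⁻¹) * (Pc * j!⁻¹)) * (Fm ⁻¹ * m!)) * p4)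
          ≈⟨ solve 11 (λ n! n!⁻¹ m! m!⁻¹ j!⁻¹ Fn Fm⁻¹ fa fb Pc p4 →
                n! :* n! :* (Fn :* n!⁻¹) :* ((((fa :* m!⁻¹) :* (fb :* m!⁻¹) :* (Pc :* j!⁻¹)) :* (Fm⁻¹ :* m!)) :* p4)
             := (n! :* n!⁻¹) :* (m! :* m!⁻¹) :* (p4 :* (fa :* fb) :* ((n! :* m!⁻¹ :* j!⁻¹) :* ((Fn :* Fm⁻¹) :* Pc))))
             refl n! n!⁻¹ m! m!⁻¹ (fact j ⁻¹) Fn (Fm ⁻¹) fa fb Pc p4 ⟩
        (n! * n!⁻¹) * (m! * m!⁻¹) * (p4 * (fa * fb) * ((n! * m!⁻¹ * fact j ⁻¹) * ((Fn * Fm ⁻¹) * Pc)))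
          ≈⟨ *-cong (*-cong (inverse _ (fact≉0 n)) (inverse _ (fact≉0 m)))
                    (*-congˡ (*-cong (sym (ι-C≈fact-ratio m j)) (*-cong (falling-ratio m j) Pc≈))) ⟩
        1# * 1# * (p4 * Φ m * (ι (n C m) * P m j))
          ≈⟨ trans (*-congʳ (*-identityˡ 1#)) (*-identityˡ _) ⟩
        p4 * Φ m * (ι (n C m) * P m j)
          ≈⟨ *-congˡ (σ-unfold n m j ≡.refl) ⟨
        p4 * Φ m * σ n m
          ∎
        where
        n : ℕ
        n = m ℕ.+ j
        n! n!⁻¹ m! m!⁻¹ j!⁻¹ Fn Fm fa fb Pc p4 : Carrier
        n! = fact n
        n!⁻¹ = fact n ⁻¹
        m! = fact m
        m!⁻¹ = fact m ⁻¹
        j!⁻¹ = fact j ⁻¹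
        Fn = falling (ι n + ρ) n
        Fm = falling (ι m + ρ) m
        fa = falling (x - r) m
        fb = falling (x + r + ι m) m
        Pc = falling (ι n + ρ + ι m) j
        p4 = pow (ι 4) m
        [Fm*m!⁻¹]⁻¹≈ : (Fm * m!⁻¹) ⁻¹ ≈ Fm ⁻¹ * fact m
        [Fm*m!⁻¹]⁻¹≈ = trans (⁻¹-* (falling-ι+ρ≉0 m m ℕ.≤-refl) (⁻¹-≉0 (fact≉0 m))) (*-congˡ (⁻¹-involutive (fact≉0 m)))
        Pc≈ : Pc ≈ rising (ρ + ι (suc (m ℕ.+ m))) j
        Pc≈ = begin
          falling (ι n + ρ + ι m) j               ≈⟨ falling-cong j (trans (+-congʳ (+-congʳ (fromℕ-+ m j))) (solve 4 (λ a b p c → a :+ b :+ p :+ c := p :+ (a :+ c) :+ b) refl (ι m) (ι j) ρ (ι m))) ⟩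
          falling (ρ + (ι m + ι m) + ι j) j       ≈⟨ falling-cong j (+-congʳ (+-congˡ (sym (fromℕ-+ m m)))) ⟩
          falling (ρ + ι (m ℕ.+ m) + ι j) j       ≈⟨ falling≈rising (ρ + ι (m ℕ.+ m)) j ⟩
          rising (ρ + ι (m ℕ.+ m) + 1#) j         ≈⟨ rising-cong j (solve 2 (λ p a → p :+ a :+ con (+ 1) := p :+ (con (+ 1) :+ a)) refl ρ (ι (m ℕ.+ m))) ⟩
          rising (ρ + ι (suc (m ℕ.+ m))) j        ∎

      fact²*rhs≈S : ∀ n → fact n * fact n * (binom (ι n + ρ) n * sumTo n (summand n)) ≈ S n
      fact²*rhs≈S n = begin
        fact n * fact n * (binom (ι n + ρ) n * sumTo n (summand n))
          ≈⟨ trans (sym (*-assoc _ _ _)) (*-distribˡ-sumTo n _ (summand n)) ⟩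
        sumTo n (λ m → fact n * fact n * binom (ι n + ρ) n * summand n m)
          ≈⟨ sumTo-cong n rescaled ⟩
        S n
          ∎
        where
        rescaled : ∀ m → m ≤ n → fact n * fact n * binom (ι n + ρ) n * summand n m ≈ pow (ι 4) m * Φ m * σ n m
        rescaled m m≤n with ℕ.m≤n⇒∃[o]m+o≡n m≤n
        ... | j , ≡.refl = fact²*binom*summand m j

theorem2p6 : ∀ {c ℓ : Level} (F : CharZeroField c ℓ) →
    let open CharZeroField F in
    let open Binomials F in
    (r : Carrier) →
    (∀ (k : ℕ) → ¬ ((ι 2 * r) ≈ - ι (ℕ.suc k))) →
    (n : ℕ) → (x : Carrier) →
    (d n r x * d n r x)
      ≈ (binom (ι n + ι 2 * r) n
          * sumTo n (λ m →
              ((binom (x - r) m * binom (x + r + ι m) m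
                 * binom (ι n + ι 2 * r + ι m) (n ℕ.∸ m))
                ÷ binom (ι m + ι 2 * r) m)
              * pow (ι 4) m))
theorem2p6 F r 2r≉-suc n x = *-cancelˡ (*-≉0 (fact≉0 n) (fact≉0 n)) (begin
  fact n * fact n * (d n r x * d n r x)   ≈⟨ solve 3 (λ f a b → f :* f :* (a :* b) := (f :* a) :* (f :* b)) refl (fact n) (d n r x) (d n r x) ⟩
  d̂ n * d̂ n                               ≈⟨ d̂*d̂≈S n ⟩
  S n                                     ≈⟨ fact²*rhs≈S 2r≉-suc n ⟨
  fact n * fact n * (binom (ι n + ρ) n * sumTo n (summand n)) ∎)
  where
  open CharZeroField F
  open Binomials F
  open Properties F
  open Point r x
  open ℤ-Solver cring using (solve; _:=_; _:*_)
  open import Relation.Binary.Reasoning.Setoid setoid
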